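{- For $\ell\in\mathbb{Z}^{+}\cup\{0\}$, \begin{align*} \sum_{n=0}^{\infty} \frac{(-1)^nq^{n^2+\ell n}}{(-q;q)_n} = \frac{1}{(-q;q)_{\infty}} \sum_{n=0}^{\infty} q^{n(n+1)/2} \sum_{m=0}^{n} \left[\begin{matrix} n+\ell-1\\ m+\ell-1\end{matrix}\right]_q \frac{q^{m^2+\ell m}}{(q;q)_m}. \end{align*}
   Context: Here $|q|<1$, $(a;q)_0=1$, $(a;q)_n=(1-a)(1-aq)\cdots(1-aq^{n-1})$, $(a;q)_\infty=\lim_{n\to\infty}(a;q)_n$, and the Gaussian polynomial is $\left[\begin{matrix} N\\ n\end{matrix}\right]_q=\frac{(q;q)_N}{(q;q)_n(q;q)_{N-n}}$ if $0\le n\le N$ and $0$ otherwise. -}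

module Defs where

-- Formal power series in q with integer coefficients, represented by their
-- coefficient function: f k is the coefficient of q^k.

open import Data.Nat as ℕ using (ℕ; zero; suc; _≡ᵇ_; _≤ᵇ_; _/_)
open import Data.Integer as ℤ using (ℤ; +_; -[1+_]; 0ℤ; 1ℤ; -1ℤ)
open import Data.Bool using (if_then_else_)

PS : Set
PS = ℕ → ℤ

Σ< : ℕ → (ℕ → ℤ) → ℤ
Σ< zero    f = 0ℤ
Σ< (suc n) f = Σ< n f ℤ.+ f n

mono : ℕ → ℤ → PS
mono e c k = if k ≡ᵇ e then c else 0ℤ

zeroPS onePS : PS
zeroPS k = 0ℤ
onePS = mono 0 1ℤ

_⊕_ : PS → PS → PS
(f ⊕ g) k = f k ℤ.+ g k

_⊖_ : PS → PS → PS
(f ⊖ g) k = f k ℤ.- g k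

infixl 7 _⊛_
infixl 6 _⊕_ _⊖_

_⊛_ : PS → PS → PS
(f ⊛ g) k = Σ< (suc k) (λ i → f i ℤ.* g (k ℕ.∸ i))

Π< : ℕ → (ℕ → PS) → PS
Π< zero    F = onePS
Π< (suc n) F = Π< n F ⊛ F n

ΣPS< : ℕ → (ℕ → PS) → PS
ΣPS< n F k = Σ< n (λ i → F i k)

-- infinite sum Σ_{n≥0} F n, for families where F n has q-adic valuation ≥ n
-- (so only n ≤ k contribute to the coefficient of q^k)
ΣPS∞ : (ℕ → PS) → PS
ΣPS∞ F k = Σ< (suc k) (λ n → F n k)

qPS : PS
qPS = mono 1 1ℤ

qPoch : PS → ℕ → PS
qPoch a n = Π< n (λ i → onePS ⊖ a ⊛ mono i 1ℤ)

-- (a;q)_∞ = lim (a;q)_n, for a of valuation ≥ 1: the coefficient of q^k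
-- is already that of (a;q)_{k+1}
qPochInf : PS → PS
qPochInf a k = qPoch a (suc k) k

-- multiplicative inverse of a series f with f 0 = 1:
-- g 0 = 1, g k = - Σ_{i=1}^{k} f i * g (k - i)
invUpTo : PS → ℕ → PS
invUpTo f zero    k = if k ≡ᵇ 0 then 1ℤ else 0ℤ
invUpTo f (suc n) k =
  if k ≤ᵇ n then invUpTo f n k
  else ℤ.- Σ< (suc n) (λ j → f (suc j) ℤ.* invUpTo f n (n ℕ.∸ j))

invPS : PS → PS
invPS f k = invUpTo f k k

-- Gaussian polynomial [N over n]_q for integers N, n:
-- (q;q)_N / ((q;q)_n (q;q)_{N-n}) if 0 ≤ n ≤ N, with the convention
-- [-1 over -1]_q = 1, and 0 otherwise.
gauss : ℤ → ℤ → PS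
gauss (+ N) (+ n) =
  if n ≤ᵇ N
  then qPoch qPS N ⊛ invPS (qPoch qPS n) ⊛ invPS (qPoch qPS (N ℕ.∸ n))
  else zeroPS
gauss -[1+ 0 ] -[1+ 0 ] = onePS
gauss _ _ = zeroPS

negqPS : PS
negqPS = mono 1 -1ℤ

lhs : ℕ → PS
lhs ℓ = ΣPS∞ (λ n →
  mono (n ℕ.* n ℕ.+ ℓ ℕ.* n) (-1ℤ ℤ.^ n) ⊛ invPS (qPoch negqPS n))

rhs : ℕ → PS
rhs ℓ = invPS (qPochInf negqPS) ⊛ ΣPS∞ (λ n →
  mono ((n ℕ.* suc n) / 2) 1ℤ ⊛
  ΣPS< (suc n) (λ m →
    gauss (+ n ℤ.+ + ℓ ℤ.- 1ℤ) (+ m ℤ.+ + ℓ ℤ.- 1ℤ)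
      ⊛ mono (m ℕ.* m ℕ.+ ℓ ℕ.* m) 1ℤ
      ⊛ invPS (qPoch qPS m)))

-- Multiply both sides by (-q;q)∞. Put euler a = Σ_s q^(s(s-1)/2 + a s) / (q;q)_s; then
-- euler a = (1 + q^a) euler (a + 1) and euler a ≡ 1 mod q^a, so (-q;q)∞ = (-q;q)_j euler (j + 1)
-- for every j, and the left side becomes Σ_j (-1)^j q^(j² + ℓj) euler (j + 1).
-- Both sides are then expanded with the q-binomial theorem in the homogeneous form
--   Σ_{i+s=r} (-1)^i q^(i(i-1)/2 + αi) q^(βs) / ((q;q)_i (q;q)_s) = Π_{t<r} (q^β - q^(α+t)) / (q;q)_r.
-- For β = 0 it expands the Gaussian polynomial [n+ℓ-1 over m+ℓ-1] = (q^(m+ℓ);q)_(n-m) / (q;q)_(n-m)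
-- on the right; for α = 0 and β = r = j it expands (-1)^j q^(j(j-1)/2) = Π_{t<j} (q^j - q^t) / (q;q)_j
-- on the left. Both sides thereby become the same triple sum
-- Σ_{m,i,s} (-1)^i q^(…) / ((q;q)_m (q;q)_i (q;q)_s).

module Submission where

open import Defs
open import Data.Nat using (ℕ)
open import Relation.Binary.PropositionalEquality using (_≡_)

open import Data.Nat as ℕ using (zero; suc; z≤n; s≤s; _≡ᵇ_; _≤ᵇ_; _/_)
  renaming (_+_ to _+ₙ_; _*_ to _*ₙ_; _∸_ to _∸ₙ_; _≤_ to _≤ₙ_; _<_ to _<ₙ_)
import Data.Nat.Properties as ℕP
open import Data.Nat.DivMod using (m*n/n≡m)
open import Data.Nat.Tactic.RingSolver as ℕSolver using ()
open import Data.Integer as ℤ using (ℤ; +_; 0ℤ; 1ℤ; -1ℤ; _+_; _*_; -_; _-_)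
import Data.Integer.Properties as ℤP
open import Data.Integer.Tactic.RingSolver as ℤSolver using ()
open import Data.Bool using (true; false; T)
open import Data.Bool.Properties using (T-≡)
open import Data.Empty using (⊥-elim)
open import Data.Maybe using (Maybe; just; nothing)
open import Data.Product using (_,_)
open import Data.Sum using (inj₁; inj₂)
open import Relation.Nullary using (yes; no)
open import Relation.Binary.PropositionalEquality
  using (_≢_; refl; sym; trans; cong; cong₂; subst; module ≡-Reasoning)
open import Algebra.Definitions.RawMagma ℕ.+-rawMagma using (_,_)
open import Algebra.Bundles using (CommutativeRing)
open import Algebra.Structures using (IsCommutativeRing)
import Algebra.Solver.Ring as RingSolver
import Algebra.Solver.Ring.AlmostCommutativeRing as ACR
import Relation.Binary.Reasoning.Setoid as SetoidReasoning
open import Function.Bundles using (Equivalence)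
open import Level using (0ℓ)

-- Finite sums of integers

Σ<-cong : ∀ n {f g : ℕ → ℤ} → (∀ i → i <ₙ n → f i ≡ g i) → Σ< n f ≡ Σ< n g
Σ<-cong zero    f≡g = refl
Σ<-cong (suc n) f≡g =
  cong₂ _+_ (Σ<-cong n (λ i i<n → f≡g i (ℕP.m<n⇒m<1+n i<n))) (f≡g n ℕP.≤-refl)

Σ<-cong′ : ∀ n {f g : ℕ → ℤ} → (∀ i → f i ≡ g i) → Σ< n f ≡ Σ< n g
Σ<-cong′ n f≡g = Σ<-cong n (λ i _ → f≡g i)

Σ<-zero : ∀ n {f : ℕ → ℤ} → (∀ i → i <ₙ n → f i ≡ 0ℤ) → Σ< n f ≡ 0ℤ
Σ<-zero zero    f≡0 = refl
Σ<-zero (suc n) f≡0 =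
  cong₂ _+_ (Σ<-zero n (λ i i<n → f≡0 i (ℕP.m<n⇒m<1+n i<n))) (f≡0 n ℕP.≤-refl)

Σ<-distrib-+ : ∀ n (f g : ℕ → ℤ) → Σ< n (λ i → f i + g i) ≡ Σ< n f + Σ< n g
Σ<-distrib-+ zero    f g = refl
Σ<-distrib-+ (suc n) f g =
  trans (cong (_+ (f n + g n)) (Σ<-distrib-+ n f g)) (interchange (Σ< n f) (Σ< n g) (f n) (g n))
  where
  interchange : ∀ a b c d → (a + b) + (c + d) ≡ (a + c) + (b + d)
  interchange = ℤSolver.solve-∀

Σ<-distrib-neg : ∀ n (f : ℕ → ℤ) → Σ< n (λ i → - f i) ≡ - Σ< n f
Σ<-distrib-neg zero    f = refl
Σ<-distrib-neg (suc n) f =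
  trans (cong (_+ (- f n)) (Σ<-distrib-neg n f)) (sym (ℤP.neg-distrib-+ (Σ< n f) (f n)))

Σ<-*ˡ : ∀ n c (f : ℕ → ℤ) → Σ< n (λ i → c * f i) ≡ c * Σ< n f
Σ<-*ˡ zero    c f = sym (ℤP.*-zeroʳ c)
Σ<-*ˡ (suc n) c f =
  trans (cong (_+ (c * f n)) (Σ<-*ˡ n c f)) (sym (ℤP.*-distribˡ-+ c (Σ< n f) (f n)))

Σ<-*ʳ : ∀ n c (f : ℕ → ℤ) → Σ< n (λ i → f i * c) ≡ Σ< n f * c
Σ<-*ʳ n c f =
  trans (Σ<-cong′ n (λ i → ℤP.*-comm (f i) c)) (trans (Σ<-*ˡ n c f) (ℤP.*-comm c _))

Σ<-sucˡ : ∀ n (f : ℕ → ℤ) → Σ< (suc n) f ≡ f 0 + Σ< n (λ i → f (suc i))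
Σ<-sucˡ zero    f = ℤP.+-comm 0ℤ (f 0)
Σ<-sucˡ (suc n) f = trans (cong (_+ f (suc n)) (Σ<-sucˡ n f)) (ℤP.+-assoc (f 0) _ _)

Σ<-+ : ∀ m n (f : ℕ → ℤ) → Σ< (m +ₙ n) f ≡ Σ< m f + Σ< n (λ i → f (m +ₙ i))
Σ<-+ m zero    f = trans (cong (λ x → Σ< x f) (ℕP.+-identityʳ m)) (sym (ℤP.+-identityʳ _))
Σ<-+ m (suc n) f = begin
  Σ< (m +ₙ suc n) f                                  ≡⟨ cong (λ x → Σ< x f) (ℕP.+-suc m n) ⟩
  Σ< (m +ₙ n) f + f (m +ₙ n)                         ≡⟨ cong (_+ f (m +ₙ n)) (Σ<-+ m n f) ⟩
  (Σ< m f + Σ< n (λ i → f (m +ₙ i))) + f (m +ₙ n)    ≡⟨ ℤP.+-assoc (Σ< m f) _ _ ⟩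
  Σ< m f + Σ< (suc n) (λ i → f (m +ₙ i))             ∎
  where open ≡-Reasoning

Σ<-truncate : ∀ n m (f : ℕ → ℤ) → n ≤ₙ m → (∀ i → n ≤ₙ i → f i ≡ 0ℤ) → Σ< m f ≡ Σ< n f
Σ<-truncate n m f n≤m f≡0 = begin
  Σ< m f
    ≡⟨ cong (λ x → Σ< x f) (sym (ℕP.m+[n∸m]≡n n≤m)) ⟩
  Σ< (n +ₙ (m ∸ₙ n)) f
    ≡⟨ Σ<-+ n (m ∸ₙ n) f ⟩
  Σ< n f + Σ< (m ∸ₙ n) (λ i → f (n +ₙ i))
    ≡⟨ cong (λ z → Σ< n f + z) (Σ<-zero (m ∸ₙ n) (λ i _ → f≡0 (n +ₙ i) (ℕP.m≤m+n n i))) ⟩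
  Σ< n f + 0ℤ
    ≡⟨ ℤP.+-identityʳ _ ⟩
  Σ< n f ∎
  where open ≡-Reasoning

Σ<-swap : ∀ m n (f : ℕ → ℕ → ℤ) →
          Σ< m (λ a → Σ< n (λ b → f a b)) ≡ Σ< n (λ b → Σ< m (λ a → f a b))
Σ<-swap zero    n f = sym (Σ<-zero n (λ _ _ → refl))
Σ<-swap (suc m) n f =
  trans (cong (_+ Σ< n (f m)) (Σ<-swap m n f)) (sym (Σ<-distrib-+ n _ _))

Σ<-reverse : ∀ n (f : ℕ → ℤ) → Σ< n f ≡ Σ< n (λ i → f (n ∸ₙ suc i))
Σ<-reverse zero    f = refl
Σ<-reverse (suc n) f = begin
  Σ< n f + f n                          ≡⟨ cong (_+ f n) (Σ<-reverse n f) ⟩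
  Σ< n (λ i → f (n ∸ₙ suc i)) + f n     ≡⟨ ℤP.+-comm _ (f n) ⟩
  f n + Σ< n (λ i → f (n ∸ₙ suc i))     ≡⟨ sym (Σ<-sucˡ n (λ i → f (n ∸ₙ i))) ⟩
  Σ< (suc n) (λ i → f (n ∸ₙ i))         ∎
  where open ≡-Reasoning

Σ<-single : ∀ n j (f : ℕ → ℤ) → j <ₙ n → (∀ i → i ≢ j → f i ≡ 0ℤ) → Σ< n f ≡ f j
Σ<-single (suc n) j f j<1+n f≡0 with ℕP.m≤n⇒m<n∨m≡n (ℕP.≤-pred j<1+n)
... | inj₁ j<n = begin
  Σ< n f + f n  ≡⟨ cong (λ z → Σ< n f + z) (f≡0 n (λ n≡j → ℕP.<-irrefl (sym n≡j) j<n)) ⟩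
  Σ< n f + 0ℤ   ≡⟨ ℤP.+-identityʳ _ ⟩
  Σ< n f        ≡⟨ Σ<-single n j f j<n f≡0 ⟩
  f j           ∎
  where open ≡-Reasoning
... | inj₂ refl = begin
  Σ< j f + f j  ≡⟨ cong (_+ f j) (Σ<-zero j (λ i i<j → f≡0 i (λ i≡j → ℕP.<-irrefl i≡j i<j))) ⟩
  0ℤ + f j      ≡⟨ ℤP.+-identityˡ _ ⟩
  f j           ∎
  where open ≡-Reasoning

Σ<-antidiagonal : ∀ N (f : ℕ → ℕ → ℤ) →
  Σ< N (λ n → Σ< (suc n) (λ m → f m (n ∸ₙ m))) ≡ Σ< N (λ a → Σ< (N ∸ₙ a) (f a))
Σ<-antidiagonal zero    f = refl
Σ<-antidiagonal (suc N) f = begin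
  Σ< N (λ n → Σ< (suc n) (λ m → f m (n ∸ₙ m))) + Σ< (suc N) (λ m → f m (N ∸ₙ m))
    ≡⟨ cong (_+ Σ< (suc N) (λ m → f m (N ∸ₙ m))) (Σ<-antidiagonal N f) ⟩
  Σ< N (λ a → Σ< (N ∸ₙ a) (f a)) + (Σ< N (λ a → f a (N ∸ₙ a)) + f N (N ∸ₙ N))
    ≡⟨ sym (ℤP.+-assoc (Σ< N (λ a → Σ< (N ∸ₙ a) (f a))) _ _) ⟩
  (Σ< N (λ a → Σ< (N ∸ₙ a) (f a)) + Σ< N (λ a → f a (N ∸ₙ a))) + f N (N ∸ₙ N)
    ≡⟨ cong₂ _+_ (sym (Σ<-distrib-+ N _ _)) lastRow ⟩
  Σ< N (λ a → Σ< (suc (N ∸ₙ a)) (f a)) + Σ< (suc N ∸ₙ N) (f N)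
    ≡⟨ cong (_+ Σ< (suc N ∸ₙ N) (f N)) (Σ<-cong N (λ a a<N →
         cong (λ x → Σ< x (f a)) (sym (ℕP.+-∸-assoc 1 (ℕP.<⇒≤ a<N))))) ⟩
  Σ< (suc N) (λ a → Σ< (suc N ∸ₙ a) (f a)) ∎
  where
  open ≡-Reasoning
  lastRow : f N (N ∸ₙ N) ≡ Σ< (suc N ∸ₙ N) (f N)
  lastRow = begin
    f N (N ∸ₙ N)  ≡⟨ cong (f N) (ℕP.n∸n≡0 N) ⟩
    f N 0         ≡⟨ sym (ℤP.+-identityˡ _) ⟩
    Σ< 1 (f N)    ≡⟨ cong (λ x → Σ< x (f N)) (sym (ℕP.m+n∸n≡m 1 N)) ⟩
    Σ< (suc N ∸ₙ N) (f N) ∎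

Σ<-antidiagonal-square : ∀ N (f : ℕ → ℕ → ℤ) → (∀ a b → N ≤ₙ a +ₙ b → f a b ≡ 0ℤ) →
  Σ< N (λ n → Σ< (suc n) (λ m → f m (n ∸ₙ m))) ≡ Σ< N (λ a → Σ< N (f a))
Σ<-antidiagonal-square N f f≡0 = trans (Σ<-antidiagonal N f) (Σ<-cong′ N (λ a →
  sym (Σ<-truncate (N ∸ₙ a) N (f a) (ℕP.m∸n≤m N a) (λ b N∸a≤b →
    f≡0 a b (ℕP.≤-trans (ℕP.m≤n+m∸n N a) (ℕP.+-monoʳ-≤ a N∸a≤b))))))

-- The ring of power series

infix 4 _≈_
_≈_ : PS → PS → Set
f ≈ g = ∀ k → f k ≡ g k

≈-refl : ∀ {f} → f ≈ f
≈-refl k = refl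

≈-sym : ∀ {f g} → f ≈ g → g ≈ f
≈-sym f≈g k = sym (f≈g k)

≈-trans : ∀ {f g h} → f ≈ g → g ≈ h → f ≈ h
≈-trans f≈g g≈h k = trans (f≈g k) (g≈h k)

≡⇒≈ : ∀ {f g} → f ≡ g → f ≈ g
≡⇒≈ refl = ≈-refl

negPS : PS → PS
negPS f k = - f k

⊕-cong : ∀ {f f′ g g′} → f ≈ f′ → g ≈ g′ → f ⊕ g ≈ f′ ⊕ g′
⊕-cong f≈f′ g≈g′ k = cong₂ _+_ (f≈f′ k) (g≈g′ k)

⊖-cong : ∀ {f f′ g g′} → f ≈ f′ → g ≈ g′ → f ⊖ g ≈ f′ ⊖ g′
⊖-cong f≈f′ g≈g′ k = cong₂ _-_ (f≈f′ k) (g≈g′ k)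

⊛-cong : ∀ {f f′ g g′} → f ≈ f′ → g ≈ g′ → f ⊛ g ≈ f′ ⊛ g′
⊛-cong f≈f′ g≈g′ k = Σ<-cong′ (suc k) (λ i → cong₂ _*_ (f≈f′ i) (g≈g′ (k ∸ₙ i)))

⊛-congˡ : ∀ {f f′} g → f ≈ f′ → f ⊛ g ≈ f′ ⊛ g
⊛-congˡ g f≈f′ = ⊛-cong f≈f′ (≈-refl {g})

⊛-congʳ : ∀ f {g g′} → g ≈ g′ → f ⊛ g ≈ f ⊛ g′
⊛-congʳ f g≈g′ = ⊛-cong (≈-refl {f}) g≈g′

⊛-comm : ∀ f g → f ⊛ g ≈ g ⊛ f
⊛-comm f g k = trans (Σ<-reverse (suc k) _) (Σ<-cong (suc k) λ i i<1+k →
  trans (cong (λ x → f (k ∸ₙ i) * g x) (ℕP.m∸[m∸n]≡n (ℕP.≤-pred i<1+k)))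
        (ℤP.*-comm (f (k ∸ₙ i)) (g i)))

⊛-distribˡ : ∀ f g h → f ⊛ (g ⊕ h) ≈ f ⊛ g ⊕ f ⊛ h
⊛-distribˡ f g h k =
  trans (Σ<-cong′ (suc k) (λ i → ℤP.*-distribˡ-+ (f i) (g (k ∸ₙ i)) (h (k ∸ₙ i))))
        (Σ<-distrib-+ (suc k) (λ i → f i * g (k ∸ₙ i)) (λ i → f i * h (k ∸ₙ i)))

⊛-distribʳ : ∀ f g h → (g ⊕ h) ⊛ f ≈ g ⊛ f ⊕ h ⊛ f
⊛-distribʳ f g h =
  ≈-trans (⊛-comm (g ⊕ h) f) (≈-trans (⊛-distribˡ f g h) (⊕-cong (⊛-comm f g) (⊛-comm f h)))

⊛-identityˡ : ∀ f → onePS ⊛ f ≈ f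
⊛-identityˡ f k = trans (Σ<-single (suc k) 0 _ (s≤s z≤n) vanish) (ℤP.*-identityˡ _)
  where
  vanish : ∀ i → i ≢ 0 → onePS i * f (k ∸ₙ i) ≡ 0ℤ
  vanish zero    i≢0 = ⊥-elim (i≢0 refl)
  vanish (suc i) _   = refl

⊛-identityʳ : ∀ f → f ⊛ onePS ≈ f
⊛-identityʳ f = ≈-trans (⊛-comm f onePS) (⊛-identityˡ f)

⊛-zeroʳ : ∀ f → f ⊛ zeroPS ≈ zeroPS
⊛-zeroʳ f k = Σ<-zero (suc k) (λ i _ → ℤP.*-zeroʳ (f i))

⊛-zeroˡ : ∀ f → zeroPS ⊛ f ≈ zeroPS
⊛-zeroˡ f k = Σ<-zero (suc k) (λ i _ → refl)

⊛-assoc : ∀ f g h → (f ⊛ g) ⊛ h ≈ f ⊛ (g ⊛ h)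
⊛-assoc f g h k = begin
  Σ< (suc k) (λ i → Σ< (suc i) (λ j → f j * g (i ∸ₙ j)) * h (k ∸ₙ i))
    ≡⟨ Σ<-cong (suc k) (λ i _ → sym (Σ<-*ʳ (suc i) (h (k ∸ₙ i)) _)) ⟩
  Σ< (suc k) (λ i → Σ< (suc i) (λ j → f j * g (i ∸ₙ j) * h (k ∸ₙ i)))
    ≡⟨ Σ<-cong′ (suc k) (λ i → Σ<-cong (suc i) (λ j j<1+i →
         cong (λ x → f j * g (i ∸ₙ j) * h (k ∸ₙ x)) (sym (ℕP.m+[n∸m]≡n (ℕP.≤-pred j<1+i))))) ⟩
  Σ< (suc k) (λ i → Σ< (suc i) (λ j → F j (i ∸ₙ j)))
    ≡⟨ Σ<-antidiagonal (suc k) F ⟩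
  Σ< (suc k) (λ a → Σ< (suc k ∸ₙ a) (F a))
    ≡⟨ Σ<-cong (suc k) (λ a a<1+k → trans
         (cong (λ x → Σ< x (F a)) (ℕP.+-∸-assoc 1 (ℕP.≤-pred a<1+k)))
         (trans (Σ<-cong′ (suc (k ∸ₙ a)) (λ b → reassociate a b)) (Σ<-*ˡ (suc (k ∸ₙ a)) (f a) _))) ⟩
  Σ< (suc k) (λ a → f a * Σ< (suc (k ∸ₙ a)) (λ b → g b * h ((k ∸ₙ a) ∸ₙ b))) ∎
  where
  open ≡-Reasoning
  F : ℕ → ℕ → ℤ
  F a b = f a * g b * h (k ∸ₙ (a +ₙ b))
  reassociate : ∀ a b → F a b ≡ f a * (g b * h ((k ∸ₙ a) ∸ₙ b))
  reassociate a b =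
    trans (cong (λ x → f a * g b * h x) (sym (ℕP.∸-+-assoc k a b))) (ℤP.*-assoc (f a) _ _)

PS-isCommutativeRing : IsCommutativeRing _≈_ _⊕_ _⊛_ negPS zeroPS onePS
PS-isCommutativeRing = record
  { isRing = record
    { +-isAbelianGroup = record
      { isGroup = record
        { isMonoid = record
          { isSemigroup = record
            { isMagma = record
              { isEquivalence = record
                { refl  = λ {f} → ≈-refl {f}
                ; sym   = λ {f} {g} → ≈-sym {f} {g}
                ; trans = λ {f} {g} {h} → ≈-trans {f} {g} {h}
                }
              ; ∙-cong = λ {f} {f′} {g} {g′} → ⊕-cong {f} {f′} {g} {g′}
              }
            ; assoc = λ f g h k → ℤP.+-assoc (f k) (g k) (h k)
            }
          ; identity = (λ f k → ℤP.+-identityˡ (f k)) , (λ f k → ℤP.+-identityʳ (f k))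
          }
        ; inverse = (λ f k → ℤP.+-inverseˡ (f k)) , (λ f k → ℤP.+-inverseʳ (f k))
        ; ⁻¹-cong = λ f≈g k → cong -_ (f≈g k)
        }
      ; comm = λ f g k → ℤP.+-comm (f k) (g k)
      }
    ; *-cong     = λ {f} {f′} {g} {g′} → ⊛-cong {f} {f′} {g} {g′}
    ; *-assoc    = ⊛-assoc
    ; *-identity = ⊛-identityˡ , ⊛-identityʳ
    ; distrib    = ⊛-distribˡ , ⊛-distribʳ
    }
  ; *-comm = ⊛-comm
  }

PS-commutativeRing : CommutativeRing 0ℓ 0ℓ
PS-commutativeRing = record { isCommutativeRing = PS-isCommutativeRing }

module ≈-Reasoning = SetoidReasoning (CommutativeRing.setoid PS-commutativeRing)

mono-≡ : ∀ e c → mono e c e ≡ c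
mono-≡ e c rewrite Equivalence.to T-≡ (ℕP.≡⇒≡ᵇ e e refl) = refl

mono-≢ : ∀ {e i} c → i ≢ e → mono e c i ≡ 0ℤ
mono-≢ {e} {i} c i≢e with i ≡ᵇ e in i≡ᵇe
... | true  = ⊥-elim (i≢e (ℕP.≡ᵇ⇒≡ i e (subst T (sym i≡ᵇe) _)))
... | false = refl

mono-cong : ∀ {a b c d} → a ≡ b → c ≡ d → mono a c ≈ mono b d
mono-cong refl refl = ≈-refl

mono-zero : ∀ a → mono a 0ℤ ≈ zeroPS
mono-zero a k with k ≡ᵇ a
... | true  = refl
... | false = refl

mono-+ : ∀ a c d → mono a c ⊕ mono a d ≈ mono a (c + d)
mono-+ a c d k with k ≡ᵇ a
... | true  = refl
... | false = refl

mono-neg : ∀ a c → negPS (mono a c) ≈ mono a (- c)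
mono-neg a c k with k ≡ᵇ a
... | true  = refl
... | false = refl

mono-⊛-below : ∀ e c f k → k <ₙ e → (mono e c ⊛ f) k ≡ 0ℤ
mono-⊛-below e c f k k<e = Σ<-zero (suc k) (λ i i<1+k →
  trans (cong (_* f (k ∸ₙ i)) (mono-≢ c (λ i≡e → ℕP.<⇒≱ k<e (subst (_≤ₙ k) i≡e (ℕP.≤-pred i<1+k)))))
        (ℤP.*-zeroˡ (f (k ∸ₙ i))))

mono-⊛-shift : ∀ e c f k → (mono e c ⊛ f) (e +ₙ k) ≡ c * f k
mono-⊛-shift e c f k = trans
  (Σ<-single (suc (e +ₙ k)) e _ (s≤s (ℕP.m≤m+n e k))
    (λ i i≢e → trans (cong (_* f (e +ₙ k ∸ₙ i)) (mono-≢ c i≢e)) (ℤP.*-zeroˡ (f (e +ₙ k ∸ₙ i)))))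
  (cong₂ _*_ (mono-≡ e c) (cong f (ℕP.m+n∸m≡n e k)))

mono-⊛-mono : ∀ a b c d → mono a c ⊛ mono b d ≈ mono (a +ₙ b) (c * d)
mono-⊛-mono a b c d k with a ℕ.≤? k
... | no  k≱a = trans (mono-⊛-below a c (mono b d) k (ℕP.≰⇒> k≱a))
                      (sym (mono-≢ (c * d) (λ k≡a+b → k≱a (subst (a ≤ₙ_) (sym k≡a+b) (ℕP.m≤m+n a b)))))
... | yes a≤k with ℕP.≤⇒≤″ a≤k
...   | k′ , refl with k′ ℕ.≟ b
...     | yes refl = trans (mono-⊛-shift a c (mono b d) b)
                           (trans (cong (c *_) (mono-≡ b d)) (sym (mono-≡ (a +ₙ b) (c * d))))
...     | no  k′≢b = trans (mono-⊛-shift a c (mono b d) k′)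
                           (trans (cong (c *_) (mono-≢ d k′≢b))
                           (trans (ℤP.*-zeroʳ c)
                                  (sym (mono-≢ (c * d) (λ a+k′≡a+b → k′≢b (ℕP.+-cancelˡ-≡ a _ _ a+k′≡a+b))))))

constPS : ℤ → PS
constPS = mono 0

constPS-homomorphism : ACR._-Raw-AlmostCommutative⟶_
  (CommutativeRing.rawRing ℤP.+-*-commutativeRing) (ACR.fromCommutativeRing PS-commutativeRing)
constPS-homomorphism = record
  { ⟦_⟧    = constPS
  ; +-homo = λ c d → ≈-sym (mono-+ 0 c d)
  ; *-homo = λ c d → ≈-sym (mono-⊛-mono 0 0 c d)
  ; -‿homo = λ c → ≈-sym (mono-neg 0 c)
  ; 0-homo = mono-zero 0
  ; 1-homo = ≈-refl
  }

constPS-≟ : ∀ c d → Maybe (constPS c ≈ constPS d)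
constPS-≟ c d with c ℤ.≟ d
... | yes refl = just ≈-refl
... | no  _    = nothing

open RingSolver (CommutativeRing.rawRing ℤP.+-*-commutativeRing)
  (ACR.fromCommutativeRing PS-commutativeRing) constPS-homomorphism constPS-≟
  using (solve; _:=_; _:+_; _:*_; _:-_; con)

Unit : PS → Set
Unit f = f 0 ≡ 1ℤ

Unit-⊛ : ∀ {f g} → Unit f → Unit g → Unit (f ⊛ g)
Unit-⊛ {f} {g} f₀≡1 g₀≡1 rewrite f₀≡1 | g₀≡1 = refl

≤⇒≤ᵇ≡true : ∀ {m n} → m ≤ₙ n → (m ≤ᵇ n) ≡ true
≤⇒≤ᵇ≡true m≤n = Equivalence.to T-≡ (ℕP.≤⇒≤ᵇ m≤n)

n<ᵇn≡false : ∀ n → (n ℕ.<ᵇ n) ≡ false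
n<ᵇn≡false zero    = refl
n<ᵇn≡false (suc n) = n<ᵇn≡false n

invUpTo-stable : ∀ f n k → k ≤ₙ n → invUpTo f n k ≡ invPS f k
invUpTo-stable f zero    zero z≤n = refl
invUpTo-stable f (suc n) k k≤1+n with ℕP.m≤n⇒m<n∨m≡n k≤1+n
... | inj₂ refl = refl
... | inj₁ k<1+n rewrite ≤⇒≤ᵇ≡true (ℕP.≤-pred k<1+n) = invUpTo-stable f n k (ℕP.≤-pred k<1+n)

invPS-suc : ∀ f n → invPS f (suc n) ≡ - Σ< (suc n) (λ j → f (suc j) * invPS f (n ∸ₙ j))
invPS-suc f n rewrite n<ᵇn≡false n =
  cong -_ (Σ<-cong (suc n) (λ j _ → cong (f (suc j) *_) (invUpTo-stable f n (n ∸ₙ j) (ℕP.m∸n≤m n j))))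

⊛-inverseʳ : ∀ f → Unit f → f ⊛ invPS f ≈ onePS
⊛-inverseʳ f f₀≡1 zero    rewrite f₀≡1 = refl
⊛-inverseʳ f f₀≡1 (suc n) = begin
  Σ< (suc (suc n)) (λ i → f i * invPS f (suc n ∸ₙ i))  ≡⟨ Σ<-sucˡ (suc n) _ ⟩
  f 0 * invPS f (suc n) + S                            ≡⟨ cong (λ x → f 0 * x + S) (invPS-suc f n) ⟩
  f 0 * (- S) + S                                      ≡⟨ cong (λ x → x * (- S) + S) f₀≡1 ⟩
  1ℤ * (- S) + S                                       ≡⟨ cancel S ⟩
  0ℤ                                                   ∎
  where
  open ≡-Reasoning
  S : ℤ
  S = Σ< (suc n) (λ j → f (suc j) * invPS f (n ∸ₙ j))
  cancel : ∀ x → 1ℤ * (- x) + x ≡ 0ℤ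
  cancel = ℤSolver.solve-∀

⊛-inverseˡ : ∀ f → Unit f → invPS f ⊛ f ≈ onePS
⊛-inverseˡ f f₀≡1 = ≈-trans (⊛-comm (invPS f) f) (⊛-inverseʳ f f₀≡1)

f⊛g≈h⇒g≈f⁻¹⊛h : ∀ f g h → Unit f → f ⊛ g ≈ h → g ≈ invPS f ⊛ h
f⊛g≈h⇒g≈f⁻¹⊛h f g h f₀≡1 fg≈h = begin
  g                     ≈⟨ ≈-sym (⊛-identityˡ g) ⟩
  onePS ⊛ g             ≈⟨ ⊛-congˡ g (≈-sym (⊛-inverseˡ f f₀≡1)) ⟩
  (invPS f ⊛ f) ⊛ g     ≈⟨ ⊛-assoc (invPS f) f g ⟩
  invPS f ⊛ (f ⊛ g)     ≈⟨ ⊛-congʳ (invPS f) fg≈h ⟩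
  invPS f ⊛ h           ∎
  where open ≈-Reasoning

⊛-cancelˡ : ∀ f g h → Unit f → f ⊛ g ≈ f ⊛ h → g ≈ h
⊛-cancelˡ f g h f₀≡1 fg≈fh =
  ≈-trans (f⊛g≈h⇒g≈f⁻¹⊛h f g (f ⊛ h) f₀≡1 fg≈fh)
          (≈-sym (f⊛g≈h⇒g≈f⁻¹⊛h f h (f ⊛ h) f₀≡1 ≈-refl))

invPS-unique : ∀ f g → Unit f → f ⊛ g ≈ onePS → invPS f ≈ g
invPS-unique f g f₀≡1 fg≈1 =
  ⊛-cancelˡ f (invPS f) g f₀≡1 (≈-trans (⊛-inverseʳ f f₀≡1) (≈-sym fg≈1))

invPS-one : invPS onePS ≈ onePS
invPS-one = invPS-unique onePS onePS refl (⊛-identityˡ onePS)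

invPS-⊛ : ∀ f g → Unit f → Unit g → invPS (f ⊛ g) ≈ invPS f ⊛ invPS g
invPS-⊛ f g f₀≡1 g₀≡1 = invPS-unique (f ⊛ g) (invPS f ⊛ invPS g) (Unit-⊛ {f} {g} f₀≡1 g₀≡1) (begin
  (f ⊛ g) ⊛ (invPS f ⊛ invPS g)
    ≈⟨ solve 4 (λ a b a′ b′ → (a :* b) :* (a′ :* b′) := (a :* a′) :* (b :* b′))
         ≈-refl f g (invPS f) (invPS g) ⟩
  (f ⊛ invPS f) ⊛ (g ⊛ invPS g)  ≈⟨ ⊛-cong (⊛-inverseʳ f f₀≡1) (⊛-inverseʳ g g₀≡1) ⟩
  onePS ⊛ onePS                  ≈⟨ ⊛-identityˡ onePS ⟩
  onePS                          ∎)
  where open ≈-Reasoning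

Π<-cong : ∀ n {F G : ℕ → PS} → (∀ i → F i ≈ G i) → Π< n F ≈ Π< n G
Π<-cong zero    F≈G = ≈-refl
Π<-cong (suc n) F≈G = ⊛-cong (Π<-cong n F≈G) (F≈G n)

Unit-Π< : ∀ n (F : ℕ → PS) → (∀ i → Unit (F i)) → Unit (Π< n F)
Unit-Π< zero    F units = refl
Unit-Π< (suc n) F units = Unit-⊛ {Π< n F} {F n} (Unit-Π< n F units) (units n)

Π<-sucˡ : ∀ n (F : ℕ → PS) → Π< (suc n) F ≈ F 0 ⊛ Π< n (λ i → F (suc i))
Π<-sucˡ zero    F = ≈-trans (⊛-identityˡ (F 0)) (≈-sym (⊛-identityʳ (F 0)))
Π<-sucˡ (suc n) F = begin
  Π< (suc n) F ⊛ F (suc n)                        ≈⟨ ⊛-congˡ (F (suc n)) (Π<-sucˡ n F) ⟩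
  (F 0 ⊛ Π< n (λ i → F (suc i))) ⊛ F (suc n)      ≈⟨ ⊛-assoc (F 0) (Π< n (λ i → F (suc i))) (F (suc n)) ⟩
  F 0 ⊛ Π< (suc n) (λ i → F (suc i))              ∎
  where open ≈-Reasoning

Π<-+ : ∀ m n (F : ℕ → PS) → Π< (m +ₙ n) F ≈ Π< m F ⊛ Π< n (λ i → F (m +ₙ i))
Π<-+ m zero    F rewrite ℕP.+-identityʳ m = ≈-sym (⊛-identityʳ (Π< m F))
Π<-+ m (suc n) F rewrite ℕP.+-suc m n = begin
  Π< (m +ₙ n) F ⊛ F (m +ₙ n)
    ≈⟨ ⊛-congˡ (F (m +ₙ n)) (Π<-+ m n F) ⟩
  (Π< m F ⊛ Π< n (λ i → F (m +ₙ i))) ⊛ F (m +ₙ n)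
    ≈⟨ ⊛-assoc (Π< m F) (Π< n (λ i → F (m +ₙ i))) (F (m +ₙ n)) ⟩
  Π< m F ⊛ Π< (suc n) (λ i → F (m +ₙ i)) ∎
  where open ≈-Reasoning

ΣPS<-cong : ∀ n {F G : ℕ → PS} → (∀ i → i <ₙ n → F i ≈ G i) → ΣPS< n F ≈ ΣPS< n G
ΣPS<-cong n F≈G k = Σ<-cong n (λ i i<n → F≈G i i<n k)

ΣPS<-sucˡ : ∀ n (F : ℕ → PS) → ΣPS< (suc n) F ≈ F 0 ⊕ ΣPS< n (λ i → F (suc i))
ΣPS<-sucˡ n F k = Σ<-sucˡ n (λ i → F i k)

ΣPS<-distrib-⊕ : ∀ n (F G : ℕ → PS) → ΣPS< n (λ i → F i ⊕ G i) ≈ ΣPS< n F ⊕ ΣPS< n G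
ΣPS<-distrib-⊕ n F G k = Σ<-distrib-+ n (λ i → F i k) (λ i → G i k)

⊛-distribˡ-ΣPS< : ∀ n g (F : ℕ → PS) → g ⊛ ΣPS< n F ≈ ΣPS< n (λ i → g ⊛ F i)
⊛-distribˡ-ΣPS< zero    g F = ⊛-zeroʳ g
⊛-distribˡ-ΣPS< (suc n) g F =
  ≈-trans (⊛-distribˡ g (ΣPS< n F) (F n)) (⊕-cong (⊛-distribˡ-ΣPS< n g F) (≈-refl {g ⊛ F n}))

⊛-distribʳ-ΣPS< : ∀ n g (F : ℕ → PS) → ΣPS< n F ⊛ g ≈ ΣPS< n (λ i → F i ⊛ g)
⊛-distribʳ-ΣPS< n g F = ≈-trans (⊛-comm (ΣPS< n F) g)
  (≈-trans (⊛-distribˡ-ΣPS< n g F) (ΣPS<-cong n (λ i _ → ⊛-comm g (F i))))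

-- Infinite sums

Summable : (ℕ → PS) → Set
Summable F = ∀ n k → k <ₙ n → F n k ≡ 0ℤ

Summable-mono-⊛ : ∀ (e : ℕ → ℕ) (c : ℕ → ℤ) (H : ℕ → PS) → (∀ n → n ≤ₙ e n) →
                  Summable (λ n → mono (e n) (c n) ⊛ H n)
Summable-mono-⊛ e c H n≤eₙ n k k<n = mono-⊛-below (e n) (c n) (H n) k (ℕP.<-≤-trans k<n (n≤eₙ n))

ΣPS∞-cong : ∀ {F G : ℕ → PS} → (∀ n → F n ≈ G n) → ΣPS∞ F ≈ ΣPS∞ G
ΣPS∞-cong F≈G k = Σ<-cong′ (suc k) (λ n → F≈G n k)

ΣPS∞-truncate : ∀ F → Summable F → ∀ k N → k <ₙ N → ΣPS∞ F k ≡ Σ< N (λ n → F n k)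
ΣPS∞-truncate F summable k N k<N =
  sym (Σ<-truncate (suc k) N (λ n → F n k) k<N (λ n k<n → summable n k k<n))

ΣPS∞-distrib-⊖ : ∀ F G → ΣPS∞ (λ n → F n ⊖ G n) ≈ ΣPS∞ F ⊖ ΣPS∞ G
ΣPS∞-distrib-⊖ F G k = trans (Σ<-distrib-+ (suc k) (λ n → F n k) (λ n → - G n k))
  (cong (λ z → ΣPS∞ F k + z) (Σ<-distrib-neg (suc k) (λ n → G n k)))

⊛-distribˡ-ΣPS∞ : ∀ g F → Summable F → g ⊛ ΣPS∞ F ≈ ΣPS∞ (λ n → g ⊛ F n)
⊛-distribˡ-ΣPS∞ g F summable k = begin
  Σ< (suc k) (λ i → g i * ΣPS∞ F (k ∸ₙ i))
    ≡⟨ Σ<-cong (suc k) (λ i _ →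
         cong (g i *_) (ΣPS∞-truncate F summable (k ∸ₙ i) (suc k) (s≤s (ℕP.m∸n≤m k i)))) ⟩
  Σ< (suc k) (λ i → g i * Σ< (suc k) (λ n → F n (k ∸ₙ i)))
    ≡⟨ Σ<-cong′ (suc k) (λ i → sym (Σ<-*ˡ (suc k) (g i) (λ n → F n (k ∸ₙ i)))) ⟩
  Σ< (suc k) (λ i → Σ< (suc k) (λ n → g i * F n (k ∸ₙ i)))
    ≡⟨ Σ<-swap (suc k) (suc k) (λ i n → g i * F n (k ∸ₙ i)) ⟩
  Σ< (suc k) (λ n → Σ< (suc k) (λ i → g i * F n (k ∸ₙ i))) ∎
  where open ≡-Reasoning

ΣPS∞-shift : ∀ F → F 0 ≈ zeroPS → Summable F → ΣPS∞ F ≈ ΣPS∞ (λ n → F (suc n))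
ΣPS∞-shift F F₀≈0 summable k = begin
  Σ< (suc k) (λ n → F n k)
    ≡⟨ Σ<-sucˡ k (λ n → F n k) ⟩
  F 0 k + Σ< k (λ n → F (suc n) k)
    ≡⟨ cong (_+ Σ< k (λ n → F (suc n) k)) (F₀≈0 k) ⟩
  0ℤ + Σ< k (λ n → F (suc n) k)
    ≡⟨ ℤP.+-identityˡ _ ⟩
  Σ< k (λ n → F (suc n) k)
    ≡⟨ sym (Σ<-truncate k (suc k) _ (ℕP.n≤1+n k) (λ n k≤n → summable (suc n) k (s≤s k≤n))) ⟩
  Σ< (suc k) (λ n → F (suc n) k) ∎
  where open ≡-Reasoning

Summable-⊛ : ∀ (F G : ℕ → PS) → Summable F → Summable (λ n → F n ⊛ G n)
Summable-⊛ F G summable n k k<n = Σ<-zero (suc k) (λ i i<1+k →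
  trans (cong (_* G n (k ∸ₙ i)) (summable n i (ℕP.≤-<-trans (ℕP.≤-pred i<1+k) k<n)))
        (ℤP.*-zeroˡ (G n (k ∸ₙ i))))

⊛-identityʳ-upTo : ∀ f g k → (∀ i → i ≤ₙ k → g i ≡ onePS i) → (f ⊛ g) k ≡ f k
⊛-identityʳ-upTo f g k g≈1 =
  trans (Σ<-cong (suc k) (λ i _ → cong (f i *_) (g≈1 (k ∸ₙ i) (ℕP.m∸n≤m k i)))) (⊛-identityʳ f k)

-- q-factorials and the q-binomial theorem

infix 8 q^_ 1-q^_

q^_ : ℕ → PS
q^ a = mono a 1ℤ

1-q^_ : ℕ → PS
1-q^ a = onePS ⊖ q^ a

q^-+ : ∀ a b → q^ a ⊛ q^ b ≈ q^ (a +ₙ b)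
q^-+ a b = mono-⊛-mono a b 1ℤ 1ℤ

1-q^0≈0 : 1-q^ 0 ≈ zeroPS
1-q^0≈0 k = ℤP.+-inverseʳ (onePS k)

1-q^-+ : ∀ a b → 1-q^ (a +ₙ b) ≈ 1-q^ a ⊕ q^ a ⊛ 1-q^ b
1-q^-+ a b = begin
  1-q^ (a +ₙ b)
    ≈⟨ ⊖-cong (≈-refl {onePS}) (≈-sym (q^-+ a b)) ⟩
  onePS ⊖ q^ a ⊛ q^ b
    ≈⟨ solve 2 (λ x y → con 1ℤ :- x :* y := (con 1ℤ :- x) :+ x :* (con 1ℤ :- y)) ≈-refl (q^ a) (q^ b) ⟩
  1-q^ a ⊕ q^ a ⊛ 1-q^ b ∎
  where open ≈-Reasoning

qFac : ℕ → PS
qFac = qPoch qPS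

qFac⁻¹ : ℕ → PS
qFac⁻¹ n = invPS (qFac n)

qPoch-qPS-factor : ∀ i → onePS ⊖ qPS ⊛ mono i 1ℤ ≈ 1-q^ (suc i)
qPoch-qPS-factor i = ⊖-cong (≈-refl {onePS}) (q^-+ 1 i)

Unit-qFac : ∀ n → Unit (qFac n)
Unit-qFac n = Unit-Π< n _ (λ i → refl)

qFac⁻¹-zero : qFac⁻¹ 0 ≈ onePS
qFac⁻¹-zero = invPS-one

qFac⁻¹-suc : ∀ n → qFac⁻¹ (suc n) ⊛ 1-q^ (suc n) ≈ qFac⁻¹ n
qFac⁻¹-suc n = begin
  qFac⁻¹ (suc n) ⊛ 1-q^ (suc n)
    ≈⟨ ⊛-cong (invPS-⊛ (qFac n) F (Unit-qFac n) refl) (≈-sym (qPoch-qPS-factor n)) ⟩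
  (qFac⁻¹ n ⊛ invPS F) ⊛ F
    ≈⟨ ⊛-assoc (qFac⁻¹ n) (invPS F) F ⟩
  qFac⁻¹ n ⊛ (invPS F ⊛ F)
    ≈⟨ ⊛-congʳ (qFac⁻¹ n) (⊛-inverseˡ F refl) ⟩
  qFac⁻¹ n ⊛ onePS
    ≈⟨ ⊛-identityʳ (qFac⁻¹ n) ⟩
  qFac⁻¹ n ∎
  where
  open ≈-Reasoning
  F : PS
  F = onePS ⊖ qPS ⊛ mono n 1ℤ

convolution : ℕ → (ℕ → PS) → (ℕ → PS) → PS
convolution r c d = ΣPS< (suc r) (λ i → c i ⊛ d (r ∸ₙ i))

-- Split 1 - q^(r+1) as (1 - q^s) + q^s (1 - q^i) on the term of index i + s = r + 1,
-- and apply the recurrence of d to the first part and that of c to the second.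
convolution-suc : ∀ (c d : ℕ → PS) A B →
  (∀ i → c (suc i) ⊛ 1-q^ (suc i) ≈ A ⊛ q^ i ⊛ c i) →
  (∀ s → d (suc s) ⊛ 1-q^ (suc s) ≈ B ⊛ d s) →
  ∀ r → 1-q^ (suc r) ⊛ convolution (suc r) c d ≈ (B ⊕ A ⊛ q^ r) ⊛ convolution r c d
convolution-suc c d A B c-rec d-rec r = begin
  1-q^ (suc r) ⊛ convolution (suc r) c d
    ≈⟨ ⊛-distribˡ-ΣPS< (suc (suc r)) (1-q^ (suc r)) (λ i → c i ⊛ d (suc r ∸ₙ i)) ⟩
  ΣPS< (suc (suc r)) (λ i → 1-q^ (suc r) ⊛ (c i ⊛ d (suc r ∸ₙ i)))
    ≈⟨ ΣPS<-cong (suc (suc r)) (λ i i<2+r → split i (ℕP.≤-pred i<2+r)) ⟩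
  ΣPS< (suc (suc r)) (λ i → X i ⊕ Y i)
    ≈⟨ ΣPS<-distrib-⊕ (suc (suc r)) X Y ⟩
  ΣPS< (suc (suc r)) X ⊕ ΣPS< (suc (suc r)) Y
    ≈⟨ ⊕-cong ΣX ΣY ⟩
  B ⊛ convolution r c d ⊕ (A ⊛ q^ r) ⊛ convolution r c d
    ≈⟨ ≈-sym (⊛-distribʳ (convolution r c d) B (A ⊛ q^ r)) ⟩
  (B ⊕ A ⊛ q^ r) ⊛ convolution r c d ∎
  where
  open ≈-Reasoning
  X Y : ℕ → PS
  X i = c i ⊛ (d (suc r ∸ₙ i) ⊛ 1-q^ (suc r ∸ₙ i))
  Y i = (q^ (suc r ∸ₙ i) ⊛ d (suc r ∸ₙ i)) ⊛ (c i ⊛ 1-q^ i)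

  split : ∀ i → i ≤ₙ suc r → 1-q^ (suc r) ⊛ (c i ⊛ d (suc r ∸ₙ i)) ≈ X i ⊕ Y i
  split i i≤1+r = begin
    1-q^ (suc r) ⊛ (c i ⊛ d s)
      ≈⟨ ⊛-congˡ (c i ⊛ d s) (≈-trans (≡⇒≈ (cong 1-q^_ (sym (ℕP.m∸n+n≡m i≤1+r)))) (1-q^-+ s i)) ⟩
    (1-q^ s ⊕ q^ s ⊛ 1-q^ i) ⊛ (c i ⊛ d s)
      ≈⟨ solve 5 (λ u v w x y → (u :+ v :* w) :* (x :* y) := x :* (y :* u) :+ (v :* y) :* (x :* w))
           ≈-refl (1-q^ s) (q^ s) (1-q^ i) (c i) (d s) ⟩
    X i ⊕ Y i ∎
    where s = suc r ∸ₙ i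

  ΣX : ΣPS< (suc (suc r)) X ≈ B ⊛ convolution r c d
  ΣX = begin
    ΣPS< (suc r) X ⊕ X (suc r)
      ≈⟨ ⊕-cong (ΣPS<-cong (suc r) (λ i i<1+r → Xᵢ i (ℕP.≤-pred i<1+r))) lastX ⟩
    ΣPS< (suc r) (λ i → B ⊛ (c i ⊛ d (r ∸ₙ i))) ⊕ zeroPS
      ≈⟨ (λ k → ℤP.+-identityʳ _) ⟩
    ΣPS< (suc r) (λ i → B ⊛ (c i ⊛ d (r ∸ₙ i)))
      ≈⟨ ≈-sym (⊛-distribˡ-ΣPS< (suc r) B (λ i → c i ⊛ d (r ∸ₙ i))) ⟩
    B ⊛ convolution r c d ∎
    where
    lastX : X (suc r) ≈ zeroPS
    lastX rewrite ℕP.n∸n≡0 r =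
      ≈-trans (⊛-congʳ (c (suc r)) (≈-trans (⊛-congʳ (d 0) 1-q^0≈0) (⊛-zeroʳ (d 0)))) (⊛-zeroʳ (c (suc r)))
    Xᵢ : ∀ i → i ≤ₙ r → X i ≈ B ⊛ (c i ⊛ d (r ∸ₙ i))
    Xᵢ i i≤r rewrite ℕP.+-∸-assoc 1 i≤r = begin
      c i ⊛ (d (suc (r ∸ₙ i)) ⊛ 1-q^ (suc (r ∸ₙ i)))
        ≈⟨ ⊛-congʳ (c i) (d-rec (r ∸ₙ i)) ⟩
      c i ⊛ (B ⊛ d (r ∸ₙ i))
        ≈⟨ solve 3 (λ x y z → x :* (y :* z) := y :* (x :* z)) ≈-refl (c i) B (d (r ∸ₙ i)) ⟩
      B ⊛ (c i ⊛ d (r ∸ₙ i)) ∎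

  ΣY : ΣPS< (suc (suc r)) Y ≈ (A ⊛ q^ r) ⊛ convolution r c d
  ΣY = begin
    ΣPS< (suc (suc r)) Y
      ≈⟨ ΣPS<-sucˡ (suc r) Y ⟩
    Y 0 ⊕ ΣPS< (suc r) (λ i → Y (suc i))
      ≈⟨ ⊕-cong firstY (ΣPS<-cong (suc r) (λ i i<1+r → Yᵢ₊₁ i (ℕP.≤-pred i<1+r))) ⟩
    zeroPS ⊕ ΣPS< (suc r) (λ i → (A ⊛ q^ r) ⊛ (c i ⊛ d (r ∸ₙ i)))
      ≈⟨ (λ k → ℤP.+-identityˡ _) ⟩
    ΣPS< (suc r) (λ i → (A ⊛ q^ r) ⊛ (c i ⊛ d (r ∸ₙ i)))
      ≈⟨ ≈-sym (⊛-distribˡ-ΣPS< (suc r) (A ⊛ q^ r) (λ i → c i ⊛ d (r ∸ₙ i))) ⟩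
    (A ⊛ q^ r) ⊛ convolution r c d ∎
    where
    firstY : Y 0 ≈ zeroPS
    firstY = ≈-trans (⊛-congʳ (q^ (suc r) ⊛ d (suc r)) (≈-trans (⊛-congʳ (c 0) 1-q^0≈0) (⊛-zeroʳ (c 0))))
                     (⊛-zeroʳ (q^ (suc r) ⊛ d (suc r)))
    Yᵢ₊₁ : ∀ i → i ≤ₙ r → Y (suc i) ≈ (A ⊛ q^ r) ⊛ (c i ⊛ d (r ∸ₙ i))
    Yᵢ₊₁ i i≤r = begin
      (q^ (r ∸ₙ i) ⊛ d (r ∸ₙ i)) ⊛ (c (suc i) ⊛ 1-q^ (suc i))
        ≈⟨ ⊛-congʳ (q^ (r ∸ₙ i) ⊛ d (r ∸ₙ i)) (c-rec i) ⟩
      (q^ (r ∸ₙ i) ⊛ d (r ∸ₙ i)) ⊛ (A ⊛ q^ i ⊛ c i)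
        ≈⟨ solve 5 (λ x y a z w → (x :* y) :* (a :* z :* w) := (a :* (x :* z)) :* (w :* y))
             ≈-refl (q^ (r ∸ₙ i)) (d (r ∸ₙ i)) A (q^ i) (c i) ⟩
      (A ⊛ (q^ (r ∸ₙ i) ⊛ q^ i)) ⊛ (c i ⊛ d (r ∸ₙ i))
        ≈⟨ ⊛-congˡ (c i ⊛ d (r ∸ₙ i))
             (⊛-congʳ A (≈-trans (q^-+ (r ∸ₙ i) i) (≡⇒≈ (cong q^_ (ℕP.m∸n+n≡m i≤r))))) ⟩
      (A ⊛ q^ r) ⊛ (c i ⊛ d (r ∸ₙ i)) ∎

convolution-closed : ∀ (c d : ℕ → PS) A B → c 0 ≈ onePS → d 0 ≈ onePS →
  (∀ i → c (suc i) ⊛ 1-q^ (suc i) ≈ A ⊛ q^ i ⊛ c i) →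
  (∀ s → d (suc s) ⊛ 1-q^ (suc s) ≈ B ⊛ d s) →
  ∀ r → convolution r c d ≈ Π< r (λ t → B ⊕ A ⊛ q^ t) ⊛ qFac⁻¹ r
convolution-closed c d A B c₀≈1 d₀≈1 c-rec d-rec zero = begin
  convolution 0 c d  ≈⟨ (λ k → ℤP.+-identityˡ _) ⟩
  c 0 ⊛ d 0          ≈⟨ ⊛-cong c₀≈1 (≈-trans d₀≈1 (≈-sym qFac⁻¹-zero)) ⟩
  onePS ⊛ qFac⁻¹ 0   ∎
  where open ≈-Reasoning
convolution-closed c d A B c₀≈1 d₀≈1 c-rec d-rec (suc r) =
  ⊛-cancelˡ (1-q^ (suc r)) _ _ refl (begin
    1-q^ (suc r) ⊛ convolution (suc r) c d
      ≈⟨ convolution-suc c d A B c-rec d-rec r ⟩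
    F r ⊛ convolution r c d
      ≈⟨ ⊛-congʳ (F r) (convolution-closed c d A B c₀≈1 d₀≈1 c-rec d-rec r) ⟩
    F r ⊛ (Π< r F ⊛ qFac⁻¹ r)
      ≈⟨ ⊛-congʳ (F r) (⊛-congʳ (Π< r F) (≈-sym (qFac⁻¹-suc r))) ⟩
    F r ⊛ (Π< r F ⊛ (qFac⁻¹ (suc r) ⊛ 1-q^ (suc r)))
      ≈⟨ solve 4 (λ x y z w → x :* (y :* (z :* w)) := w :* ((y :* x) :* z))
           ≈-refl (F r) (Π< r F) (qFac⁻¹ (suc r)) (1-q^ (suc r)) ⟩
    1-q^ (suc r) ⊛ (Π< (suc r) F ⊛ qFac⁻¹ (suc r)) ∎)
  where
  open ≈-Reasoning
  F : ℕ → PS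
  F t = B ⊕ A ⊛ q^ t

choose2 : ℕ → ℕ
choose2 zero    = 0
choose2 (suc n) = choose2 n +ₙ n

choose2-*2 : ∀ n → choose2 n *ₙ 2 +ₙ n ≡ n *ₙ n
choose2-*2 zero    = refl
choose2-*2 (suc n) =
  trans (rearrange (choose2 n) n) (trans (cong (λ x → x +ₙ 2 *ₙ n +ₙ 1) (choose2-*2 n)) (square n))
  where
  rearrange : ∀ c n → (c +ₙ n) *ₙ 2 +ₙ suc n ≡ c *ₙ 2 +ₙ n +ₙ 2 *ₙ n +ₙ 1
  rearrange = ℕSolver.solve-∀
  square : ∀ n → n *ₙ n +ₙ 2 *ₙ n +ₙ 1 ≡ suc n *ₙ suc n
  square = ℕSolver.solve-∀

choose2-suc-half : ∀ n → (n *ₙ suc n) / 2 ≡ choose2 (suc n)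
choose2-suc-half n = trans (cong (_/ 2) n[n+1]≡2c) (m*n/n≡m (choose2 (suc n)) 2)
  where
  n[n+1]≡2c : n *ₙ suc n ≡ choose2 (suc n) *ₙ 2
  n[n+1]≡2c = begin
    n *ₙ suc n                     ≡⟨ expand n ⟩
    n *ₙ n +ₙ n                    ≡⟨ cong (_+ₙ n) (sym (choose2-*2 n)) ⟩
    choose2 n *ₙ 2 +ₙ n +ₙ n       ≡⟨ collect (choose2 n) n ⟩
    (choose2 n +ₙ n) *ₙ 2          ∎
    where
    open ≡-Reasoning
    expand : ∀ n → n *ₙ suc n ≡ n *ₙ n +ₙ n
    expand = ℕSolver.solve-∀
    collect : ∀ c n → c *ₙ 2 +ₙ n +ₙ n ≡ (c +ₙ n) *ₙ 2
    collect = ℕSolver.solve-∀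

choose2-square : ∀ j → choose2 (suc j) +ₙ choose2 j ≡ j *ₙ j
choose2-square j = trans (rearrange (choose2 j) j) (choose2-*2 j)
  where
  rearrange : ∀ c j → c +ₙ j +ₙ c ≡ c *ₙ 2 +ₙ j
  rearrange = ℕSolver.solve-∀

choose2-+ : ∀ a b → choose2 (a +ₙ b) ≡ choose2 a +ₙ choose2 b +ₙ a *ₙ b
choose2-+ a zero    = trans (cong choose2 (ℕP.+-identityʳ a)) (pad (choose2 a) a)
  where
  pad : ∀ c a → c ≡ c +ₙ 0 +ₙ a *ₙ 0
  pad = ℕSolver.solve-∀
choose2-+ a (suc b) = trans (cong choose2 (ℕP.+-suc a b))
  (trans (cong (_+ₙ (a +ₙ b)) (choose2-+ a b)) (rearrange (choose2 a) (choose2 b) a b))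
  where
  rearrange : ∀ ca cb a b → ca +ₙ cb +ₙ a *ₙ b +ₙ (a +ₙ b) ≡ ca +ₙ (cb +ₙ b) +ₙ a *ₙ suc b
  rearrange = ℕSolver.solve-∀

eulerTerm : ℤ → ℕ → ℕ → PS
eulerTerm ε α i = mono (choose2 i +ₙ α *ₙ i) (ε ℤ.^ i) ⊛ qFac⁻¹ i

powerTerm : ℕ → ℕ → PS
powerTerm β s = q^ (β *ₙ s) ⊛ qFac⁻¹ s

mono-⊛-qFac⁻¹-zero : ∀ e c → e ≡ 0 → c ≡ 1ℤ → mono e c ⊛ qFac⁻¹ 0 ≈ onePS
mono-⊛-qFac⁻¹-zero .0 .1ℤ refl refl = ≈-trans (⊛-identityˡ (qFac⁻¹ 0)) qFac⁻¹-zero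

eulerTerm-zero : ∀ ε α → eulerTerm ε α 0 ≈ onePS
eulerTerm-zero ε α = mono-⊛-qFac⁻¹-zero (α *ₙ 0) 1ℤ (ℕP.*-zeroʳ α) refl

powerTerm-zero : ∀ β → powerTerm β 0 ≈ onePS
powerTerm-zero β = mono-⊛-qFac⁻¹-zero (β *ₙ 0) 1ℤ (ℕP.*-zeroʳ β) refl

mono-⊛-qFac⁻¹-suc : ∀ e c n → (mono e c ⊛ qFac⁻¹ (suc n)) ⊛ 1-q^ (suc n) ≈ mono e c ⊛ qFac⁻¹ n
mono-⊛-qFac⁻¹-suc e c n =
  ≈-trans (⊛-assoc (mono e c) (qFac⁻¹ (suc n)) (1-q^ (suc n))) (⊛-congʳ (mono e c) (qFac⁻¹-suc n))

eulerTerm-suc : ∀ ε α i → eulerTerm ε α (suc i) ⊛ 1-q^ (suc i) ≈ mono α ε ⊛ q^ i ⊛ eulerTerm ε α i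
eulerTerm-suc ε α i = begin
  eulerTerm ε α (suc i) ⊛ 1-q^ (suc i)
    ≈⟨ mono-⊛-qFac⁻¹-suc (choose2 (suc i) +ₙ α *ₙ suc i) (ε ℤ.^ suc i) i ⟩
  mono (choose2 (suc i) +ₙ α *ₙ suc i) (ε ℤ.^ suc i) ⊛ qFac⁻¹ i
    ≈⟨ ⊛-congˡ (qFac⁻¹ i) (mono-cong exponent coefficient) ⟩
  mono (α +ₙ i +ₙ E) (ε * 1ℤ * ε ℤ.^ i) ⊛ qFac⁻¹ i
    ≈⟨ ⊛-congˡ (qFac⁻¹ i) (≈-sym (≈-trans (⊛-congˡ (mono E (ε ℤ.^ i)) (mono-⊛-mono α i ε 1ℤ))
                                           (mono-⊛-mono (α +ₙ i) E (ε * 1ℤ) (ε ℤ.^ i)))) ⟩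
  (mono α ε ⊛ q^ i ⊛ mono E (ε ℤ.^ i)) ⊛ qFac⁻¹ i
    ≈⟨ ⊛-assoc (mono α ε ⊛ q^ i) (mono E (ε ℤ.^ i)) (qFac⁻¹ i) ⟩
  mono α ε ⊛ q^ i ⊛ eulerTerm ε α i ∎
  where
  open ≈-Reasoning
  E : ℕ
  E = choose2 i +ₙ α *ₙ i
  exponent : choose2 i +ₙ i +ₙ α *ₙ suc i ≡ α +ₙ i +ₙ E
  exponent = rearrange (choose2 i) i α
    where
    rearrange : ∀ t i a → t +ₙ i +ₙ a *ₙ suc i ≡ a +ₙ i +ₙ (t +ₙ a *ₙ i)
    rearrange = ℕSolver.solve-∀
  coefficient : ε ℤ.^ suc i ≡ ε * 1ℤ * ε ℤ.^ i
  coefficient = cong (_* ε ℤ.^ i) (sym (ℤP.*-identityʳ ε))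

powerTerm-suc : ∀ β s → powerTerm β (suc s) ⊛ 1-q^ (suc s) ≈ q^ β ⊛ powerTerm β s
powerTerm-suc β s = begin
  powerTerm β (suc s) ⊛ 1-q^ (suc s)
    ≈⟨ mono-⊛-qFac⁻¹-suc (β *ₙ suc s) 1ℤ s ⟩
  q^ (β *ₙ suc s) ⊛ qFac⁻¹ s
    ≈⟨ ⊛-congˡ (qFac⁻¹ s) (≈-trans (≡⇒≈ (cong q^_ (ℕP.*-suc β s))) (≈-sym (q^-+ β (β *ₙ s)))) ⟩
  (q^ β ⊛ q^ (β *ₙ s)) ⊛ qFac⁻¹ s
    ≈⟨ ⊛-assoc (q^ β) (q^ (β *ₙ s)) (qFac⁻¹ s) ⟩
  q^ β ⊛ powerTerm β s ∎
  where open ≈-Reasoning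

q-binomial : ∀ α β r →
  convolution r (eulerTerm -1ℤ α) (powerTerm β) ≈ Π< r (λ t → q^ β ⊖ q^ (α +ₙ t)) ⊛ qFac⁻¹ r
q-binomial α β r = begin
  convolution r (eulerTerm -1ℤ α) (powerTerm β)
    ≈⟨ convolution-closed (eulerTerm -1ℤ α) (powerTerm β) (mono α -1ℤ) (q^ β)
         (eulerTerm-zero -1ℤ α) (powerTerm-zero β) (eulerTerm-suc -1ℤ α) (powerTerm-suc β) r ⟩
  Π< r (λ t → q^ β ⊕ mono α -1ℤ ⊛ q^ t) ⊛ qFac⁻¹ r
    ≈⟨ ⊛-congˡ (qFac⁻¹ r) (Π<-cong r (λ t →
         ⊕-cong (≈-refl {q^ β}) (≈-trans (mono-⊛-mono α t -1ℤ 1ℤ) (≈-sym (mono-neg (α +ₙ t) 1ℤ))))) ⟩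
  Π< r (λ t → q^ β ⊖ q^ (α +ₙ t)) ⊛ qFac⁻¹ r ∎
  where open ≈-Reasoning

Π<-q^-⊛ : ∀ a r (F : ℕ → PS) → Π< r (λ t → q^ a ⊛ F t) ≈ q^ (a *ₙ r) ⊛ Π< r F
Π<-q^-⊛ a zero    F =
  ≈-sym (≈-trans (⊛-congˡ onePS (≡⇒≈ (cong q^_ (ℕP.*-zeroʳ a)))) (⊛-identityʳ onePS))
Π<-q^-⊛ a (suc r) F = begin
  Π< r (λ t → q^ a ⊛ F t) ⊛ (q^ a ⊛ F r)
    ≈⟨ ⊛-congˡ (q^ a ⊛ F r) (Π<-q^-⊛ a r F) ⟩
  (q^ (a *ₙ r) ⊛ Π< r F) ⊛ (q^ a ⊛ F r)
    ≈⟨ solve 4 (λ x y z w → (x :* y) :* (z :* w) := (x :* z) :* (y :* w))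
         ≈-refl (q^ (a *ₙ r)) (Π< r F) (q^ a) (F r) ⟩
  (q^ (a *ₙ r) ⊛ q^ a) ⊛ (Π< r F ⊛ F r)
    ≈⟨ ⊛-congˡ (Π< r F ⊛ F r) (≈-trans (q^-+ (a *ₙ r) a) (≡⇒≈ (cong q^_ a*r+a≡a*[1+r]))) ⟩
  q^ (a *ₙ suc r) ⊛ Π< (suc r) F ∎
  where
  open ≈-Reasoning
  a*r+a≡a*[1+r] : a *ₙ r +ₙ a ≡ a *ₙ suc r
  a*r+a≡a*[1+r] = trans (ℕP.+-comm (a *ₙ r) a) (sym (ℕP.*-suc a r))

sgn : ℕ → ℤ
sgn n = -1ℤ ℤ.^ n

Π<-q^n⊖q^t : ∀ n → Π< n (λ t → q^ n ⊖ q^ t) ≈ mono (choose2 n) (sgn n) ⊛ qFac n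
Π<-q^n⊖q^t zero    = ≈-sym (⊛-identityʳ onePS)
Π<-q^n⊖q^t (suc n) = begin
  Π< (suc n) (λ t → q^ suc n ⊖ q^ t)
    ≈⟨ Π<-sucˡ n (λ t → q^ suc n ⊖ q^ t) ⟩
  (q^ suc n ⊖ onePS) ⊛ Π< n (λ t → q^ suc n ⊖ q^ suc t)
    ≈⟨ ⊛-congʳ (q^ suc n ⊖ onePS) (≈-trans (Π<-cong n factor) (Π<-q^-⊛ 1 n (λ t → q^ n ⊖ q^ t))) ⟩
  (q^ suc n ⊖ onePS) ⊛ (q^ (1 *ₙ n) ⊛ Π< n (λ t → q^ n ⊖ q^ t))
    ≈⟨ ⊛-congʳ (q^ suc n ⊖ onePS) (⊛-congʳ (q^ (1 *ₙ n)) (Π<-q^n⊖q^t n)) ⟩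
  (q^ suc n ⊖ onePS) ⊛ (q^ (1 *ₙ n) ⊛ (M ⊛ qFac n))
    ≈⟨ solve 4 (λ a x y p → (a :- con 1ℤ) :* (x :* (y :* p)) := con -1ℤ :* (x :* y) :* (p :* (con 1ℤ :- a)))
         ≈-refl (q^ suc n) (q^ (1 *ₙ n)) M (qFac n) ⟩
  (constPS -1ℤ ⊛ (q^ (1 *ₙ n) ⊛ M)) ⊛ (qFac n ⊛ 1-q^ suc n)
    ≈⟨ ⊛-cong monomial (⊛-congʳ (qFac n) (≈-sym (qPoch-qPS-factor n))) ⟩
  mono (choose2 (suc n)) (sgn (suc n)) ⊛ qFac (suc n) ∎
  where
  open ≈-Reasoning
  M : PS
  M = mono (choose2 n) (sgn n)
  factor : ∀ t → q^ suc n ⊖ q^ suc t ≈ q^ 1 ⊛ (q^ n ⊖ q^ t)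
  factor t = ≈-sym (begin
    q^ 1 ⊛ (q^ n ⊖ q^ t)
      ≈⟨ solve 3 (λ x y z → x :* (y :- z) := x :* y :- x :* z) ≈-refl (q^ 1) (q^ n) (q^ t) ⟩
    q^ 1 ⊛ q^ n ⊖ q^ 1 ⊛ q^ t
      ≈⟨ ⊖-cong (q^-+ 1 n) (q^-+ 1 t) ⟩
    q^ suc n ⊖ q^ suc t ∎)
  monomial : constPS -1ℤ ⊛ (q^ (1 *ₙ n) ⊛ M) ≈ mono (choose2 (suc n)) (sgn (suc n))
  monomial = begin
    constPS -1ℤ ⊛ (q^ (1 *ₙ n) ⊛ M)
      ≈⟨ ⊛-congʳ (constPS -1ℤ) (mono-⊛-mono (1 *ₙ n) (choose2 n) 1ℤ (sgn n)) ⟩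
    constPS -1ℤ ⊛ mono (1 *ₙ n +ₙ choose2 n) (1ℤ * sgn n)
      ≈⟨ mono-⊛-mono 0 (1 *ₙ n +ₙ choose2 n) -1ℤ (1ℤ * sgn n) ⟩
    mono (1 *ₙ n +ₙ choose2 n) (-1ℤ * (1ℤ * sgn n))
      ≈⟨ mono-cong (trans (cong (_+ₙ choose2 n) (ℕP.*-identityˡ n)) (ℕP.+-comm n (choose2 n)))
                   (cong (-1ℤ *_) (ℤP.*-identityˡ (sgn n))) ⟩
    mono (choose2 (suc n)) (sgn (suc n)) ∎

q^choose2-convolution : ∀ j → mono (choose2 j) (sgn j) ≈ convolution j (eulerTerm -1ℤ 0) (powerTerm j)
q^choose2-convolution j = ≈-sym (begin
  convolution j (eulerTerm -1ℤ 0) (powerTerm j)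
    ≈⟨ q-binomial 0 j j ⟩
  Π< j (λ t → q^ j ⊖ q^ t) ⊛ qFac⁻¹ j
    ≈⟨ ⊛-congˡ (qFac⁻¹ j) (Π<-q^n⊖q^t j) ⟩
  (mono (choose2 j) (sgn j) ⊛ qFac j) ⊛ qFac⁻¹ j
    ≈⟨ ⊛-assoc (mono (choose2 j) (sgn j)) (qFac j) (qFac⁻¹ j) ⟩
  mono (choose2 j) (sgn j) ⊛ (qFac j ⊛ qFac⁻¹ j)
    ≈⟨ ⊛-congʳ (mono (choose2 j) (sgn j)) (⊛-inverseʳ (qFac j) (Unit-qFac j)) ⟩
  mono (choose2 j) (sgn j) ⊛ onePS
    ≈⟨ ⊛-identityʳ _ ⟩
  mono (choose2 j) (sgn j) ∎)
  where open ≈-Reasoning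

-- Euler's expansion of (-q;q)∞

euler : ℕ → PS
euler a = ΣPS∞ (eulerTerm 1ℤ a)

Summable-eulerTerm : ∀ ε a → Summable (eulerTerm ε (suc a))
Summable-eulerTerm ε a = Summable-mono-⊛ (λ s → choose2 s +ₙ suc a *ₙ s) (ε ℤ.^_) qFac⁻¹
  (λ s → ℕP.≤-trans (ℕP.m≤m+n s (a *ₙ s)) (ℕP.m≤n+m (suc a *ₙ s) (choose2 s)))

eulerTerm-shift : ∀ ε α s → eulerTerm ε (suc α) s ≈ q^ s ⊛ eulerTerm ε α s
eulerTerm-shift ε α s = begin
  mono (choose2 s +ₙ suc α *ₙ s) (ε ℤ.^ s) ⊛ qFac⁻¹ s
    ≈⟨ ⊛-congˡ (qFac⁻¹ s) (≈-trans (mono-cong exponent (sym (ℤP.*-identityˡ (ε ℤ.^ s))))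
                                   (≈-sym (mono-⊛-mono s (choose2 s +ₙ α *ₙ s) 1ℤ (ε ℤ.^ s)))) ⟩
  (q^ s ⊛ mono (choose2 s +ₙ α *ₙ s) (ε ℤ.^ s)) ⊛ qFac⁻¹ s
    ≈⟨ ⊛-assoc (q^ s) (mono (choose2 s +ₙ α *ₙ s) (ε ℤ.^ s)) (qFac⁻¹ s) ⟩
  q^ s ⊛ eulerTerm ε α s ∎
  where
  open ≈-Reasoning
  exponent : choose2 s +ₙ suc α *ₙ s ≡ s +ₙ (choose2 s +ₙ α *ₙ s)
  exponent = rearrange (choose2 s) s α
    where
    rearrange : ∀ t s a → t +ₙ suc a *ₙ s ≡ s +ₙ (t +ₙ a *ₙ s)
    rearrange = ℕSolver.solve-∀

-- The s-th term of euler a - euler (a + 1) is q^(choose2 s + a s) (1 - q^s) / (q;q)_s: it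
-- vanishes for s = 0, and for s + 1 it is q^a times the s-th term of euler (a + 1).
euler-suc : ∀ a → euler (suc a) ≈ (onePS ⊕ q^ (suc a)) ⊛ euler (suc (suc a))
euler-suc a = begin
  euler A
    ≈⟨ solve 2 (λ x y → x := (x :- y) :+ y) ≈-refl (euler A) (euler A′) ⟩
  (euler A ⊖ euler A′) ⊕ euler A′
    ≈⟨ ⊕-cong difference (≈-refl {euler A′}) ⟩
  q^ A ⊛ euler A′ ⊕ euler A′
    ≈⟨ solve 2 (λ x y → x :* y :+ y := (con 1ℤ :+ x) :* y) ≈-refl (q^ A) (euler A′) ⟩
  (onePS ⊕ q^ A) ⊛ euler A′ ∎
  where
  open ≈-Reasoning
  A A′ : ℕ
  A  = suc a
  A′ = suc A
  D : ℕ → PS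
  D s = eulerTerm 1ℤ A s ⊛ 1-q^ s

  termwise : ∀ s → eulerTerm 1ℤ A s ⊖ eulerTerm 1ℤ A′ s ≈ D s
  termwise s = begin
    eulerTerm 1ℤ A s ⊖ eulerTerm 1ℤ A′ s
      ≈⟨ ⊖-cong (≈-refl {eulerTerm 1ℤ A s}) (eulerTerm-shift 1ℤ A s) ⟩
    eulerTerm 1ℤ A s ⊖ q^ s ⊛ eulerTerm 1ℤ A s
      ≈⟨ solve 2 (λ x y → x :- y :* x := x :* (con 1ℤ :- y)) ≈-refl (eulerTerm 1ℤ A s) (q^ s) ⟩
    D s ∎

  D-suc : ∀ s → D (suc s) ≈ q^ A ⊛ eulerTerm 1ℤ A′ s
  D-suc s = begin
    D (suc s)                               ≈⟨ eulerTerm-suc 1ℤ A s ⟩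
    q^ A ⊛ q^ s ⊛ eulerTerm 1ℤ A s          ≈⟨ ⊛-assoc (q^ A) (q^ s) (eulerTerm 1ℤ A s) ⟩
    q^ A ⊛ (q^ s ⊛ eulerTerm 1ℤ A s)        ≈⟨ ⊛-congʳ (q^ A) (≈-sym (eulerTerm-shift 1ℤ A s)) ⟩
    q^ A ⊛ eulerTerm 1ℤ A′ s                ∎

  difference : euler A ⊖ euler A′ ≈ q^ A ⊛ euler A′
  difference = begin
    euler A ⊖ euler A′
      ≈⟨ ≈-sym (ΣPS∞-distrib-⊖ (eulerTerm 1ℤ A) (eulerTerm 1ℤ A′)) ⟩
    ΣPS∞ (λ s → eulerTerm 1ℤ A s ⊖ eulerTerm 1ℤ A′ s)
      ≈⟨ ΣPS∞-cong termwise ⟩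
    ΣPS∞ D
      ≈⟨ ΣPS∞-shift D (≈-trans (⊛-congʳ (eulerTerm 1ℤ A 0) 1-q^0≈0) (⊛-zeroʳ (eulerTerm 1ℤ A 0)))
                      (Summable-⊛ (eulerTerm 1ℤ A) 1-q^_ (Summable-eulerTerm 1ℤ a)) ⟩
    ΣPS∞ (λ s → D (suc s))
      ≈⟨ ΣPS∞-cong D-suc ⟩
    ΣPS∞ (λ s → q^ A ⊛ eulerTerm 1ℤ A′ s)
      ≈⟨ ≈-sym (⊛-distribˡ-ΣPS∞ (q^ A) (eulerTerm 1ℤ A′) (Summable-eulerTerm 1ℤ A)) ⟩
    q^ A ⊛ euler A′ ∎

euler-low : ∀ a k → k ≤ₙ a → euler (suc a) k ≡ onePS k
euler-low a k k≤a = begin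
  Σ< (suc k) (λ s → eulerTerm 1ℤ (suc a) s k)
    ≡⟨ Σ<-sucˡ k (λ s → eulerTerm 1ℤ (suc a) s k) ⟩
  eulerTerm 1ℤ (suc a) 0 k + Σ< k (λ s → eulerTerm 1ℤ (suc a) (suc s) k)
    ≡⟨ cong₂ _+_ (eulerTerm-zero 1ℤ (suc a) k)
                 (Σ<-zero k (λ s _ → mono-⊛-below _ _ (qFac⁻¹ (suc s)) k (below s))) ⟩
  onePS k + 0ℤ
    ≡⟨ ℤP.+-identityʳ _ ⟩
  onePS k ∎
  where
  open ≡-Reasoning
  below : ∀ s → k <ₙ choose2 (suc s) +ₙ suc a *ₙ suc s
  below s = ℕP.<-≤-trans (s≤s k≤a) (ℕP.≤-trans (ℕP.m≤m*n (suc a) (suc s)) (ℕP.m≤n+m _ (choose2 (suc s))))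

negqPoch : ℕ → PS
negqPoch = qPoch negqPS

negqPoch-factor : ∀ i → onePS ⊖ negqPS ⊛ mono i 1ℤ ≈ onePS ⊕ q^ (suc i)
negqPoch-factor i k = trans (cong (λ z → onePS k - z) (mono-⊛-mono 1 i -1ℤ 1ℤ k)) (minus-neg k)
  where
  minus-neg : ∀ k → onePS k - mono (suc i) -1ℤ k ≡ onePS k + (q^ (suc i)) k
  minus-neg k with k ≡ᵇ suc i
  ... | true  = refl
  ... | false = refl

Unit-negqPoch : ∀ n → Unit (negqPoch n)
Unit-negqPoch n = Unit-Π< n _ (λ i → refl)

negqPoch-stable : ∀ n d k → k ≤ₙ n → negqPoch (n +ₙ d) k ≡ negqPoch n k
negqPoch-stable n zero    k k≤n rewrite ℕP.+-identityʳ n = refl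
negqPoch-stable n (suc d) k k≤n rewrite ℕP.+-suc n d =
  trans (⊛-identityʳ-upTo (negqPoch (n +ₙ d)) _ k factor≈1) (negqPoch-stable n d k k≤n)
  where
  factor≈1 : ∀ i → i ≤ₙ k → (onePS ⊖ negqPS ⊛ mono (n +ₙ d) 1ℤ) i ≡ onePS i
  factor≈1 i i≤k = begin
    (onePS ⊖ negqPS ⊛ mono (n +ₙ d) 1ℤ) i  ≡⟨ negqPoch-factor (n +ₙ d) i ⟩
    onePS i + (q^ suc (n +ₙ d)) i          ≡⟨ cong (λ z → onePS i + z) (mono-≢ 1ℤ i≢1+n+d) ⟩
    onePS i + 0ℤ                           ≡⟨ ℤP.+-identityʳ _ ⟩
    onePS i                                ∎
    where
    open ≡-Reasoning
    i≢1+n+d : i ≢ suc (n +ₙ d)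
    i≢1+n+d = ℕP.<⇒≢ (s≤s (ℕP.≤-trans i≤k (ℕP.≤-trans k≤n (ℕP.m≤m+n n d))))

negqPoch-⊛-euler : ∀ j t → negqPoch j ⊛ euler (suc j) ≈ negqPoch (t +ₙ j) ⊛ euler (suc (t +ₙ j))
negqPoch-⊛-euler j zero    = ≈-refl
negqPoch-⊛-euler j (suc t) = begin
  negqPoch j ⊛ euler (suc j)
    ≈⟨ negqPoch-⊛-euler j t ⟩
  negqPoch m ⊛ euler (suc m)
    ≈⟨ ⊛-congʳ (negqPoch m) (euler-suc m) ⟩
  negqPoch m ⊛ ((onePS ⊕ q^ (suc m)) ⊛ euler (suc (suc m)))
    ≈⟨ ≈-sym (⊛-assoc (negqPoch m) (onePS ⊕ q^ (suc m)) (euler (suc (suc m)))) ⟩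
  (negqPoch m ⊛ (onePS ⊕ q^ (suc m))) ⊛ euler (suc (suc m))
    ≈⟨ ⊛-congˡ (euler (suc (suc m))) (⊛-congʳ (negqPoch m) (≈-sym (negqPoch-factor m))) ⟩
  negqPoch (suc m) ⊛ euler (suc (suc m)) ∎
  where
  open ≈-Reasoning
  m : ℕ
  m = t +ₙ j

-- The coefficient of q^k is read off at stage j + k + 1, where euler is 1 up to degree k.
qPochInf-negqPS : ∀ j → qPochInf negqPS ≈ negqPoch j ⊛ euler (suc j)
qPochInf-negqPS j k = sym (begin
  (negqPoch j ⊛ euler (suc j)) k
    ≡⟨ negqPoch-⊛-euler j (suc k) k ⟩
  (negqPoch M ⊛ euler (suc M)) k
    ≡⟨ ⊛-identityʳ-upTo (negqPoch M) (euler (suc M)) k (λ i i≤k → euler-low M i (ℕP.≤-trans i≤k k≤M)) ⟩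
  negqPoch M k
    ≡⟨ negqPoch-stable (suc k) j k (ℕP.n≤1+n k) ⟩
  negqPoch (suc k) k ∎)
  where
  open ≡-Reasoning
  M : ℕ
  M = suc k +ₙ j
  k≤M : k ≤ₙ M
  k≤M = ℕP.≤-trans (ℕP.n≤1+n k) (ℕP.m≤m+n (suc k) j)

lhsTerm : ℕ → ℕ → PS
lhsTerm ℓ n = mono (n *ₙ n +ₙ ℓ *ₙ n) (-1ℤ ℤ.^ n)

qPochInf-⊛-lhs : ∀ ℓ → qPochInf negqPS ⊛ lhs ℓ ≈ ΣPS∞ (λ j → lhsTerm ℓ j ⊛ euler (suc j))
qPochInf-⊛-lhs ℓ = ≈-trans
  (⊛-distribˡ-ΣPS∞ (qPochInf negqPS) F (Summable-mono-⊛ _ _ (λ n → invPS (negqPoch n)) n≤n²+ℓn))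
  (ΣPS∞-cong termwise)
  where
  open ≈-Reasoning
  F : ℕ → PS
  F n = lhsTerm ℓ n ⊛ invPS (negqPoch n)
  n≤n²+ℓn : ∀ n → n ≤ₙ n *ₙ n +ₙ ℓ *ₙ n
  n≤n²+ℓn zero    = z≤n
  n≤n²+ℓn (suc n) = ℕP.≤-trans (ℕP.m≤m*n (suc n) (suc n)) (ℕP.m≤m+n _ _)
  termwise : ∀ n → qPochInf negqPS ⊛ F n ≈ lhsTerm ℓ n ⊛ euler (suc n)
  termwise n = begin
    qPochInf negqPS ⊛ F n
      ≈⟨ ⊛-congˡ (F n) (qPochInf-negqPS n) ⟩
    (negqPoch n ⊛ euler (suc n)) ⊛ (lhsTerm ℓ n ⊛ invPS (negqPoch n))
      ≈⟨ solve 4 (λ a b c d → (a :* b) :* (c :* d) := (c :* b) :* (a :* d)) ≈-refl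
           (negqPoch n) (euler (suc n)) (lhsTerm ℓ n) (invPS (negqPoch n)) ⟩
    (lhsTerm ℓ n ⊛ euler (suc n)) ⊛ (negqPoch n ⊛ invPS (negqPoch n))
      ≈⟨ ⊛-congʳ (lhsTerm ℓ n ⊛ euler (suc n)) (⊛-inverseʳ (negqPoch n) (Unit-negqPoch n)) ⟩
    (lhsTerm ℓ n ⊛ euler (suc n)) ⊛ onePS
      ≈⟨ ⊛-identityʳ _ ⟩
    lhsTerm ℓ n ⊛ euler (suc n) ∎

-- Gaussian polynomials

qFac-+ : ∀ B r → qFac (B +ₙ r) ≈ qFac B ⊛ Π< r (λ t → 1-q^ (suc B +ₙ t))
qFac-+ B r = ≈-trans (Π<-+ B r _) (⊛-congʳ (qFac B) (Π<-cong r (λ t → qPoch-qPS-factor (B +ₙ t))))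

gauss-+ : ∀ B r → gauss (+ (B +ₙ r)) (+ B) ≈ Π< r (λ t → 1-q^ (suc B +ₙ t)) ⊛ qFac⁻¹ r
gauss-+ B r rewrite ≤⇒≤ᵇ≡true (ℕP.m≤m+n B r) | ℕP.m+n∸m≡n B r = begin
  qFac (B +ₙ r) ⊛ qFac⁻¹ B ⊛ qFac⁻¹ r
    ≈⟨ ⊛-congˡ (qFac⁻¹ r) (⊛-congˡ (qFac⁻¹ B) (qFac-+ B r)) ⟩
  qFac B ⊛ Q ⊛ qFac⁻¹ B ⊛ qFac⁻¹ r
    ≈⟨ solve 4 (λ a b c d → a :* b :* c :* d := (b :* d) :* (a :* c))
         ≈-refl (qFac B) Q (qFac⁻¹ B) (qFac⁻¹ r) ⟩
  (Q ⊛ qFac⁻¹ r) ⊛ (qFac B ⊛ qFac⁻¹ B)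
    ≈⟨ ⊛-congʳ (Q ⊛ qFac⁻¹ r) (⊛-inverseʳ (qFac B) (Unit-qFac B)) ⟩
  (Q ⊛ qFac⁻¹ r) ⊛ onePS
    ≈⟨ ⊛-identityʳ (Q ⊛ qFac⁻¹ r) ⟩
  Q ⊛ qFac⁻¹ r ∎
  where
  open ≈-Reasoning
  Q : PS
  Q = Π< r (λ t → 1-q^ (suc B +ₙ t))

-- For M = 0 this relies on the conventions [r - 1 over -1] = 0 for r > 0 and [-1 over -1] = 1.
gauss-pred : ∀ M r →
  gauss (+ (M +ₙ r) ℤ.- 1ℤ) (+ M ℤ.- 1ℤ) ≈ Π< r (λ t → 1-q^ (M +ₙ t)) ⊛ qFac⁻¹ r
gauss-pred (suc B) r       = gauss-+ B r
gauss-pred zero    zero    = ≈-sym (≈-trans (⊛-identityˡ (qFac⁻¹ 0)) qFac⁻¹-zero)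
gauss-pred zero    (suc r) = ≈-sym (begin
  Π< (suc r) 1-q^_ ⊛ qFac⁻¹ (suc r)
    ≈⟨ ⊛-congˡ (qFac⁻¹ (suc r)) (Π<-sucˡ r 1-q^_) ⟩
  (1-q^ 0 ⊛ Q) ⊛ qFac⁻¹ (suc r)
    ≈⟨ ⊛-congˡ (qFac⁻¹ (suc r)) (≈-trans (⊛-congˡ Q 1-q^0≈0) (⊛-zeroˡ Q)) ⟩
  zeroPS ⊛ qFac⁻¹ (suc r)
    ≈⟨ ⊛-zeroˡ (qFac⁻¹ (suc r)) ⟩
  zeroPS ∎)
  where
  open ≈-Reasoning
  Q : PS
  Q = Π< r (λ t → 1-q^ suc t)

gauss-convolution : ∀ ℓ n m → m ≤ₙ n →
  gauss (+ n ℤ.+ + ℓ ℤ.- 1ℤ) (+ m ℤ.+ + ℓ ℤ.- 1ℤ)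
    ≈ convolution (n ∸ₙ m) (eulerTerm -1ℤ (m +ₙ ℓ)) (powerTerm 0)
gauss-convolution ℓ n m m≤n = begin
  gauss (+ (n +ₙ ℓ) ℤ.- 1ℤ) (+ (m +ₙ ℓ) ℤ.- 1ℤ)
    ≈⟨ ≡⇒≈ (cong (λ x → gauss (+ x ℤ.- 1ℤ) (+ (m +ₙ ℓ) ℤ.- 1ℤ)) n+ℓ≡m+ℓ+[n∸m]) ⟩
  gauss (+ (m +ₙ ℓ +ₙ (n ∸ₙ m)) ℤ.- 1ℤ) (+ (m +ₙ ℓ) ℤ.- 1ℤ)
    ≈⟨ gauss-pred (m +ₙ ℓ) (n ∸ₙ m) ⟩
  Π< (n ∸ₙ m) (λ t → 1-q^ (m +ₙ ℓ +ₙ t)) ⊛ qFac⁻¹ (n ∸ₙ m)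
    ≈⟨ ≈-sym (q-binomial (m +ₙ ℓ) 0 (n ∸ₙ m)) ⟩
  convolution (n ∸ₙ m) (eulerTerm -1ℤ (m +ₙ ℓ)) (powerTerm 0) ∎
  where
  open ≈-Reasoning
  n+ℓ≡m+ℓ+[n∸m] : n +ₙ ℓ ≡ m +ₙ ℓ +ₙ (n ∸ₙ m)
  n+ℓ≡m+ℓ+[n∸m] = trans (cong (_+ₙ ℓ) (sym (ℕP.m+[n∸m]≡n m≤n))) (swap m (n ∸ₙ m) ℓ)
    where
    swap : ∀ a b c → a +ₙ b +ₙ c ≡ a +ₙ c +ₙ b
    swap = ℕSolver.solve-∀

-- Both sides as one triple sum

cellExponent : ℕ → ℕ → ℕ → ℕ → ℕ
cellExponent ℓ m i s =
  choose2 (suc (m +ₙ i +ₙ s)) +ₙ choose2 i +ₙ (m +ₙ ℓ) *ₙ i +ₙ (m *ₙ m +ₙ ℓ *ₙ m)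

-- On the right, m is the inner summation index and i + s = n - m; on the left, i + m = j
-- and s indexes euler (j + 1).
cell : ℕ → ℕ → ℕ → ℕ → PS
cell ℓ m i s = mono (cellExponent ℓ m i s) (sgn i) ⊛ (qFac⁻¹ i ⊛ qFac⁻¹ s ⊛ qFac⁻¹ m)

cell-below : ∀ ℓ m i s k → k <ₙ m +ₙ i +ₙ s → cell ℓ m i s k ≡ 0ℤ
cell-below ℓ m i s k k<m+i+s =
  mono-⊛-below (cellExponent ℓ m i s) (sgn i) (qFac⁻¹ i ⊛ qFac⁻¹ s ⊛ qFac⁻¹ m) k
    (ℕP.<-≤-trans k<m+i+s (ℕP.≤-trans (ℕP.m≤n+m (m +ₙ i +ₙ s) (choose2 (m +ₙ i +ₙ s)))
      (ℕP.≤-trans (ℕP.m≤m+n _ _) (ℕP.≤-trans (ℕP.m≤m+n _ _) (ℕP.m≤m+n _ _)))))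

mono-⊛-mono³ : ∀ a b c d x y z w →
  mono a x ⊛ mono b y ⊛ mono c z ⊛ mono d w ≈ mono (a +ₙ b +ₙ c +ₙ d) (x * y * z * w)
mono-⊛-mono³ a b c d x y z w = begin
  mono a x ⊛ mono b y ⊛ mono c z ⊛ mono d w
    ≈⟨ ⊛-congˡ (mono d w) (⊛-congˡ (mono c z) (mono-⊛-mono a b x y)) ⟩
  mono (a +ₙ b) (x * y) ⊛ mono c z ⊛ mono d w
    ≈⟨ ⊛-congˡ (mono d w) (mono-⊛-mono (a +ₙ b) c (x * y) z) ⟩
  mono (a +ₙ b +ₙ c) (x * y * z) ⊛ mono d w
    ≈⟨ mono-⊛-mono (a +ₙ b +ₙ c) d (x * y * z) w ⟩
  mono (a +ₙ b +ₙ c +ₙ d) (x * y * z * w) ∎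
  where open ≈-Reasoning

rhs-cell : ∀ ℓ n m i s → n ≡ m +ₙ i +ₙ s →
  q^ choose2 (suc n) ⊛ (eulerTerm -1ℤ (m +ₙ ℓ) i ⊛ powerTerm 0 s ⊛ q^ (m *ₙ m +ₙ ℓ *ₙ m) ⊛ qFac⁻¹ m)
  ≈ cell ℓ m i s
rhs-cell ℓ .(m +ₙ i +ₙ s) m i s refl = begin
  x ⊛ ((a ⊛ qFac⁻¹ i) ⊛ (b ⊛ qFac⁻¹ s) ⊛ c ⊛ qFac⁻¹ m)
    ≈⟨ solve 7 (λ x a p b q c r → x :* ((a :* p) :* (b :* q) :* c :* r) := (x :* a :* b :* c) :* (p :* q :* r))
         ≈-refl x a (qFac⁻¹ i) b (qFac⁻¹ s) c (qFac⁻¹ m) ⟩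
  (x ⊛ a ⊛ b ⊛ c) ⊛ (qFac⁻¹ i ⊛ qFac⁻¹ s ⊛ qFac⁻¹ m)
    ≈⟨ ⊛-congˡ (qFac⁻¹ i ⊛ qFac⁻¹ s ⊛ qFac⁻¹ m)
         (≈-trans (mono-⊛-mono³ _ _ _ _ 1ℤ (sgn i) 1ℤ 1ℤ) (mono-cong exponent coefficient)) ⟩
  cell ℓ m i s ∎
  where
  open ≈-Reasoning
  t : ℕ
  x a b c : PS
  t = choose2 (suc (m +ₙ i +ₙ s))
  x = q^ t
  a = mono (choose2 i +ₙ (m +ₙ ℓ) *ₙ i) (sgn i)
  b = q^ (0 *ₙ s)
  c = q^ (m *ₙ m +ₙ ℓ *ₙ m)
  exponent : t +ₙ (choose2 i +ₙ (m +ₙ ℓ) *ₙ i) +ₙ 0 *ₙ s +ₙ (m *ₙ m +ₙ ℓ *ₙ m)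
             ≡ cellExponent ℓ m i s
  exponent = rearrange t (choose2 i) (m *ₙ m +ₙ ℓ *ₙ m) ((m +ₙ ℓ) *ₙ i) s
    where
    rearrange : ∀ t c e f s → t +ₙ (c +ₙ f) +ₙ 0 *ₙ s +ₙ e ≡ t +ₙ c +ₙ f +ₙ e
    rearrange = ℕSolver.solve-∀
  coefficient : 1ℤ * sgn i * 1ℤ * 1ℤ ≡ sgn i
  coefficient = normalise (sgn i)
    where
    normalise : ∀ x → 1ℤ * x * 1ℤ * 1ℤ ≡ x
    normalise = ℤSolver.solve-∀

rhsTerm : ℕ → ℕ → PS
rhsTerm ℓ n = mono ((n *ₙ suc n) / 2) 1ℤ ⊛ ΣPS< (suc n) (λ m →
  gauss (+ n ℤ.+ + ℓ ℤ.- 1ℤ) (+ m ℤ.+ + ℓ ℤ.- 1ℤ) ⊛ q^ (m *ₙ m +ₙ ℓ *ₙ m) ⊛ qFac⁻¹ m)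

rhsTerm-cells : ∀ ℓ n →
  rhsTerm ℓ n ≈ ΣPS< (suc n) (λ m → ΣPS< (suc (n ∸ₙ m)) (λ i → cell ℓ m i (n ∸ₙ m ∸ₙ i)))
rhsTerm-cells ℓ n = begin
  rhsTerm ℓ n
    ≈⟨ ⊛-congˡ (ΣPS< (suc n) S) (≡⇒≈ (cong q^_ (choose2-suc-half n))) ⟩
  x ⊛ ΣPS< (suc n) S
    ≈⟨ ⊛-distribˡ-ΣPS< (suc n) x S ⟩
  ΣPS< (suc n) (λ m → x ⊛ S m)
    ≈⟨ ΣPS<-cong (suc n) (λ m m<1+n → summand m (ℕP.≤-pred m<1+n)) ⟩
  ΣPS< (suc n) (λ m → ΣPS< (suc (n ∸ₙ m)) (λ i → cell ℓ m i (n ∸ₙ m ∸ₙ i))) ∎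
  where
  open ≈-Reasoning
  x : PS
  x = q^ choose2 (suc n)
  S : ℕ → PS
  S m = gauss (+ n ℤ.+ + ℓ ℤ.- 1ℤ) (+ m ℤ.+ + ℓ ℤ.- 1ℤ) ⊛ q^ (m *ₙ m +ₙ ℓ *ₙ m) ⊛ qFac⁻¹ m

  summand : ∀ m → m ≤ₙ n → x ⊛ S m ≈ ΣPS< (suc (n ∸ₙ m)) (λ i → cell ℓ m i (n ∸ₙ m ∸ₙ i))
  summand m m≤n = begin
    x ⊛ S m
      ≈⟨ ⊛-congʳ x (⊛-congˡ (qFac⁻¹ m) (⊛-congˡ c (gauss-convolution ℓ n m m≤n))) ⟩
    x ⊛ (convolution r C D ⊛ c ⊛ qFac⁻¹ m)
      ≈⟨ ⊛-congʳ x (≈-trans (⊛-congˡ (qFac⁻¹ m) (⊛-distribʳ-ΣPS< (suc r) c CD))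
                            (⊛-distribʳ-ΣPS< (suc r) (qFac⁻¹ m) (λ i → CD i ⊛ c))) ⟩
    x ⊛ ΣPS< (suc r) (λ i → CD i ⊛ c ⊛ qFac⁻¹ m)
      ≈⟨ ⊛-distribˡ-ΣPS< (suc r) x (λ i → CD i ⊛ c ⊛ qFac⁻¹ m) ⟩
    ΣPS< (suc r) (λ i → x ⊛ (CD i ⊛ c ⊛ qFac⁻¹ m))
      ≈⟨ ΣPS<-cong (suc r) (λ i i<1+r → rhs-cell ℓ n m i (r ∸ₙ i) (n≡m+i+[r∸i] i (ℕP.≤-pred i<1+r))) ⟩
    ΣPS< (suc r) (λ i → cell ℓ m i (r ∸ₙ i)) ∎
    where
    r : ℕ
    c : PS
    C D : ℕ → PS
    r = n ∸ₙ m
    c = q^ (m *ₙ m +ₙ ℓ *ₙ m)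
    C = eulerTerm -1ℤ (m +ₙ ℓ)
    D = powerTerm 0
    CD : ℕ → PS
    CD i = C i ⊛ D (r ∸ₙ i)
    n≡m+i+[r∸i] : ∀ i → i ≤ₙ r → n ≡ m +ₙ i +ₙ (r ∸ₙ i)
    n≡m+i+[r∸i] i i≤r =
      sym (trans (ℕP.+-assoc m i (r ∸ₙ i)) (trans (cong (m +ₙ_) (ℕP.m+[n∸m]≡n i≤r)) (ℕP.m+[n∸m]≡n m≤n)))

lhs-cell : ∀ ℓ j m i s → j ≡ m +ₙ i →
  (q^ (choose2 (suc j) +ₙ ℓ *ₙ j) ⊛ (eulerTerm -1ℤ 0 i ⊛ powerTerm j m)) ⊛ eulerTerm 1ℤ (suc j) s
  ≈ cell ℓ m i s
lhs-cell ℓ .(m +ₙ i) m i s refl = begin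
  (x ⊛ ((a ⊛ qFac⁻¹ i) ⊛ (b ⊛ qFac⁻¹ m))) ⊛ (c ⊛ qFac⁻¹ s)
    ≈⟨ solve 7 (λ x a p b q c r → (x :* ((a :* p) :* (b :* q))) :* (c :* r) := (x :* a :* b :* c) :* (p :* r :* q))
         ≈-refl x a (qFac⁻¹ i) b (qFac⁻¹ m) c (qFac⁻¹ s) ⟩
  (x ⊛ a ⊛ b ⊛ c) ⊛ (qFac⁻¹ i ⊛ qFac⁻¹ s ⊛ qFac⁻¹ m)
    ≈⟨ ⊛-congˡ (qFac⁻¹ i ⊛ qFac⁻¹ s ⊛ qFac⁻¹ m)
         (≈-trans (mono-⊛-mono³ _ _ _ _ 1ℤ (sgn i) 1ℤ (1ℤ ℤ.^ s)) (mono-cong exponent coefficient)) ⟩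
  cell ℓ m i s ∎
  where
  open ≈-Reasoning
  j : ℕ
  x a b c : PS
  j = m +ₙ i
  x = q^ (choose2 (suc j) +ₙ ℓ *ₙ j)
  a = mono (choose2 i +ₙ 0 *ₙ i) (sgn i)
  b = q^ (j *ₙ m)
  c = mono (choose2 s +ₙ suc j *ₙ s) (1ℤ ℤ.^ s)
  exponent : choose2 (suc j) +ₙ ℓ *ₙ j +ₙ (choose2 i +ₙ 0 *ₙ i) +ₙ j *ₙ m +ₙ (choose2 s +ₙ suc j *ₙ s)
             ≡ cellExponent ℓ m i s
  exponent = trans (rearrange (choose2 (suc j)) (choose2 i) (choose2 s) ℓ m i s)
    (cong (λ y → y +ₙ choose2 i +ₙ (m +ₙ ℓ) *ₙ i +ₙ (m *ₙ m +ₙ ℓ *ₙ m)) (sym (choose2-+ (suc j) s)))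
    where
    rearrange : ∀ t ti ts ℓ m i s →
      t +ₙ ℓ *ₙ (m +ₙ i) +ₙ (ti +ₙ 0 *ₙ i) +ₙ (m +ₙ i) *ₙ m +ₙ (ts +ₙ suc (m +ₙ i) *ₙ s)
      ≡ t +ₙ ts +ₙ suc (m +ₙ i) *ₙ s +ₙ ti +ₙ (m +ₙ ℓ) *ₙ i +ₙ (m *ₙ m +ₙ ℓ *ₙ m)
    rearrange = ℕSolver.solve-∀
  coefficient : 1ℤ * sgn i * 1ℤ * 1ℤ ℤ.^ s ≡ sgn i
  coefficient = trans (cong (1ℤ * sgn i * 1ℤ *_) (ℤP.^-zeroˡ s)) (normalise (sgn i))
    where
    normalise : ∀ x → 1ℤ * x * 1ℤ * 1ℤ ≡ x
    normalise = ℤSolver.solve-∀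

lhsTerm-cells : ∀ ℓ j s →
  lhsTerm ℓ j ⊛ eulerTerm 1ℤ (suc j) s ≈ ΣPS< (suc j) (λ i → cell ℓ (j ∸ₙ i) i s)
lhsTerm-cells ℓ j s = begin
  lhsTerm ℓ j ⊛ E
    ≈⟨ ⊛-congˡ E (≈-trans (mono-cong exponent (sym (ℤP.*-identityˡ (sgn j))))
                          (≈-sym (mono-⊛-mono _ (choose2 j) 1ℤ (sgn j)))) ⟩
  (x ⊛ mono (choose2 j) (sgn j)) ⊛ E
    ≈⟨ ⊛-congˡ E (⊛-congʳ x (q^choose2-convolution j)) ⟩
  (x ⊛ convolution j C D) ⊛ E
    ≈⟨ ≈-trans (⊛-congˡ E (⊛-distribˡ-ΣPS< (suc j) x CD))
               (⊛-distribʳ-ΣPS< (suc j) E (λ i → x ⊛ CD i)) ⟩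
  ΣPS< (suc j) (λ i → (x ⊛ CD i) ⊛ E)
    ≈⟨ ΣPS<-cong (suc j) (λ i i<1+j → lhs-cell ℓ j (j ∸ₙ i) i s (sym (ℕP.m∸n+n≡m (ℕP.≤-pred i<1+j)))) ⟩
  ΣPS< (suc j) (λ i → cell ℓ (j ∸ₙ i) i s) ∎
  where
  open ≈-Reasoning
  x E : PS
  C D : ℕ → PS
  x = q^ (choose2 (suc j) +ₙ ℓ *ₙ j)
  E = eulerTerm 1ℤ (suc j) s
  C = eulerTerm -1ℤ 0
  D = powerTerm j
  CD : ℕ → PS
  CD i = C i ⊛ D (j ∸ₙ i)
  exponent : j *ₙ j +ₙ ℓ *ₙ j ≡ choose2 (suc j) +ₙ ℓ *ₙ j +ₙ choose2 j
  exponent = trans (cong (_+ₙ ℓ *ₙ j) (sym (choose2-square j)))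
                   (swap (choose2 (suc j)) (choose2 j) (ℓ *ₙ j))
    where
    swap : ∀ a b c → a +ₙ b +ₙ c ≡ a +ₙ c +ₙ b
    swap = ℕSolver.solve-∀

cellSum : ℕ → ℕ → ℤ
cellSum ℓ k = Σ< (suc k) (λ m → Σ< (suc k) (λ i → Σ< (suc k) (λ s → cell ℓ m i s k)))

rhs-cellSum : ∀ ℓ k → ΣPS∞ (rhsTerm ℓ) k ≡ cellSum ℓ k
rhs-cellSum ℓ k = begin
  Σ< K (λ n → rhsTerm ℓ n k)
    ≡⟨ Σ<-cong′ K (λ n → rhsTerm-cells ℓ n k) ⟩
  Σ< K (λ n → Σ< (suc n) (λ m → f m (n ∸ₙ m)))
    ≡⟨ Σ<-antidiagonal-square K f f-vanishes ⟩
  Σ< K (λ m → Σ< K (f m))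
    ≡⟨ Σ<-cong′ K (λ m → Σ<-antidiagonal-square K (λ i s → cell ℓ m i s k) (cell-vanishes m)) ⟩
  cellSum ℓ k ∎
  where
  open ≡-Reasoning
  K : ℕ
  K = suc k
  f : ℕ → ℕ → ℤ
  f m r = Σ< (suc r) (λ i → cell ℓ m i (r ∸ₙ i) k)
  cell-vanishes : ∀ m i s → K ≤ₙ i +ₙ s → cell ℓ m i s k ≡ 0ℤ
  cell-vanishes m i s K≤i+s = cell-below ℓ m i s k
    (ℕP.≤-trans K≤i+s (ℕP.≤-trans (ℕP.m≤n+m (i +ₙ s) m) (ℕP.≤-reflexive (sym (ℕP.+-assoc m i s)))))
  f-vanishes : ∀ m r → K ≤ₙ m +ₙ r → f m r ≡ 0ℤ
  f-vanishes m r K≤m+r = Σ<-zero (suc r) (λ i i<1+r → cell-below ℓ m i (r ∸ₙ i) k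
    (ℕP.<-≤-trans K≤m+r (ℕP.≤-reflexive (m+r≡m+i+[r∸i] (ℕP.≤-pred i<1+r)))))
    where
    m+r≡m+i+[r∸i] : ∀ {i} → i ≤ₙ r → m +ₙ r ≡ m +ₙ i +ₙ (r ∸ₙ i)
    m+r≡m+i+[r∸i] {i} i≤r = trans (cong (m +ₙ_) (sym (ℕP.m+[n∸m]≡n i≤r))) (sym (ℕP.+-assoc m i (r ∸ₙ i)))

lhs-cellSum : ∀ ℓ k → ΣPS∞ (λ j → lhsTerm ℓ j ⊛ euler (suc j)) k ≡ cellSum ℓ k
lhs-cellSum ℓ k = begin
  Σ< K (λ j → (lhsTerm ℓ j ⊛ euler (suc j)) k)
    ≡⟨ Σ<-cong′ K (λ j →
         trans (⊛-distribˡ-ΣPS∞ (lhsTerm ℓ j) (eulerTerm 1ℤ (suc j)) (Summable-eulerTerm 1ℤ j) k)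
               (Σ<-cong′ K (λ s → lhsTerm-cells ℓ j s k))) ⟩
  Σ< K (λ j → Σ< K (λ s → Σ< (suc j) (λ i → F (j ∸ₙ i) i s)))
    ≡⟨ Σ<-swap K K (λ j s → Σ< (suc j) (λ i → F (j ∸ₙ i) i s)) ⟩
  Σ< K (λ s → Σ< K (λ j → Σ< (suc j) (λ i → F (j ∸ₙ i) i s)))
    ≡⟨ Σ<-cong′ K (λ s → Σ<-antidiagonal-square K (λ i m → F m i s) (λ i m K≤i+m → cell-below ℓ m i s k
         (ℕP.≤-trans K≤i+m (ℕP.≤-trans (ℕP.≤-reflexive (ℕP.+-comm i m)) (ℕP.m≤m+n (m +ₙ i) s))))) ⟩
  Σ< K (λ s → Σ< K (λ i → Σ< K (λ m → F m i s)))
    ≡⟨ Σ<-cong′ K (λ s → Σ<-swap K K (λ i m → F m i s)) ⟩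
  Σ< K (λ s → Σ< K (λ m → Σ< K (λ i → F m i s)))
    ≡⟨ Σ<-swap K K (λ s m → Σ< K (λ i → F m i s)) ⟩
  Σ< K (λ m → Σ< K (λ s → Σ< K (λ i → F m i s)))
    ≡⟨ Σ<-cong′ K (λ m → Σ<-swap K K (λ s i → F m i s)) ⟩
  cellSum ℓ k ∎
  where
  open ≡-Reasoning
  K : ℕ
  K = suc k
  F : ℕ → ℕ → ℕ → ℤ
  F m i s = cell ℓ m i s k

theorem4p5 : (ℓ : ℕ) → (k : ℕ) → lhs ℓ k ≡ rhs ℓ k
theorem4p5 ℓ = f⊛g≈h⇒g≈f⁻¹⊛h (qPochInf negqPS) (lhs ℓ) (ΣPS∞ (rhsTerm ℓ)) refl (begin
  qPochInf negqPS ⊛ lhs ℓ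
    ≈⟨ qPochInf-⊛-lhs ℓ ⟩
  ΣPS∞ (λ j → lhsTerm ℓ j ⊛ euler (suc j))
    ≈⟨ (λ k → trans (lhs-cellSum ℓ k) (sym (rhs-cellSum ℓ k))) ⟩
  ΣPS∞ (rhsTerm ℓ) ∎)
  where open ≈-Reasoning
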